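{- Let $G$ be a finite graph with $m$ edges. Then $v(G)=m+l(G)+2e(G)$ if and only if $G$ is almost triangle-free.
   Context: Graphs are finite and simple. A linear hypergraph is a pair $\pi=(P,\mathcal L)$ with $P$ a finite set of points and $\mathcal L$ a set of subsets of $P$ (lines) such that any two distinct points lie in at most one line and every line has at least two points. Its intersection graph $G_\pi$ has vertex set $\mathcal L$, two distinct lines adjacent iff they intersect. $v(G)$ is the minimum number of points of a linear hypergraph whose intersection graph is isomorphic to $G$. $l(G)$ is the number of vertices of degree $1$ (leaves) and $e(G)$ the number of isolated vertices of $G$. A graph is almost triangle-free if it is obtained as follows: start with a triangle-free graph $G_0=(V_0,E_0)$; at each vertex $a\in V_0$ glue an arbitrary number (possibly zero) of triangles, each triangle having exactly the one vertex $a$ in common with $G_0$ and two new vertices, where distinct glued triangles share no vertices other than (possibly) their common vertex of $G_0$. -}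

module Defs where

open import Data.Nat using (ℕ; zero; suc; _+_; _*_; _≤_; _≡ᵇ_; _<ᵇ_)
open import Data.Fin using (Fin; zero; suc; toℕ)
open import Data.Bool using (Bool; true; false; _∧_; if_then_else_)
open import Data.Product using (Σ; ∃; _×_; _,_)
open import Data.Sum using (_⊎_; inj₁; inj₂)
open import Data.Empty using (⊥)
open import Relation.Nullary using (¬_)
open import Relation.Binary.PropositionalEquality using (_≡_; _≢_)
open import Function.Bundles using (_↔_; Inverse; _⇔_)

countF : ∀ {n} → (Fin n → Bool) → ℕ
countF {zero}  f = 0
countF {suc n} f = (if f zero then 1 else 0) + countF (λ i → f (suc i))

sumF : ∀ {n} → (Fin n → ℕ) → ℕ
sumF {zero}  f = 0
sumF {suc n} f = f zero + sumF (λ i → f (suc i))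

record Graph (n : ℕ) : Set where
  field
    adj    : Fin n → Fin n → Bool
    sym    : ∀ i j → adj i j ≡ adj j i
    irrefl : ∀ i → adj i i ≡ false
open Graph public

degree : ∀ {n} → Graph n → Fin n → ℕ
degree G i = countF (adj G i)

edges : ∀ {n} → Graph n → ℕ
edges G = sumF (λ i → countF (λ j → (toℕ i <ᵇ toℕ j) ∧ adj G i j))

leaves : ∀ {n} → Graph n → ℕ
leaves G = countF (λ i → degree G i ≡ᵇ 1)

isolated : ∀ {n} → Graph n → ℕ
isolated G = countF (λ i → degree G i ≡ᵇ 0)

-- Linear hypergraphs on the point set Fin p whose intersection graph is
-- isomorphic to G.  The isomorphism G_π ≅ G is used to index the lines
-- by the vertices of G: line i is the subset (characteristic function)
-- lines i of Fin p.

record Representation {n : ℕ} (G : Graph n) (p : ℕ) : Set where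
  field
    lines    : Fin n → Fin p → Bool
    -- distinct vertices give distinct lines (so 𝓛 is a set of n lines)
    distinct : ∀ i j → i ≢ j → ¬ (∀ x → lines i x ≡ lines j x)
    size≥2   : ∀ i → 2 ≤ countF (lines i)
    linear   : ∀ i j → i ≢ j → countF (λ x → lines i x ∧ lines j x) ≤ 1
    isInter  : ∀ i j → i ≢ j →
               (adj G i j ≡ true) ⇔ (∃ λ x → (lines i x ∧ lines j x) ≡ true)

IsV : ∀ {n} → Graph n → ℕ → Set
IsV G N = Representation G N × (∀ p → Representation G p → N ≤ p)

TriangleFree : ∀ {n} → Graph n → Set
TriangleFree G = ∀ a b c → adj G a b ≡ true → adj G b c ≡ true →
                 adj G a c ≡ true → ⊥

-- Vertices of G0 with t triangles glued: old vertices, and for each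
-- triangle s the two new vertices (s , 0), (s , 1).
-- Triangle s is glued at the vertex att s of G0.
GluedAdj : ∀ {n₀ t} → Graph n₀ → (Fin t → Fin n₀) →
           (Fin n₀ ⊎ (Fin t × Fin 2)) → (Fin n₀ ⊎ (Fin t × Fin 2)) → Set
GluedAdj G₀ att (inj₁ a)       (inj₁ b)       = adj G₀ a b ≡ true
GluedAdj G₀ att (inj₁ a)       (inj₂ (s , _)) = att s ≡ a
GluedAdj G₀ att (inj₂ (s , _)) (inj₁ a)       = att s ≡ a
GluedAdj G₀ att (inj₂ (s , x)) (inj₂ (r , y)) = (s ≡ r) × (x ≢ y)

AlmostTriangleFree : ∀ {n} → Graph n → Set
AlmostTriangleFree {n} G =
  Σ ℕ λ n₀ → Σ ℕ λ t → Σ (Graph n₀) λ G₀ → Σ (Fin t → Fin n₀) λ att →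
  TriangleFree G₀ ×
  Σ (Fin n ↔ (Fin n₀ ⊎ (Fin t × Fin 2))) λ φ →
    ∀ i j → (adj G i j ≡ true) ⇔ GluedAdj G₀ att (Inverse.to φ i) (Inverse.to φ j)

{-# OPTIONS --safe #-}
module Submission where

-- Every graph has the standard representation: one point for each edge, on the lines of
-- its two ends, one private point for each leaf and two for each isolated vertex; so
-- v(G) ≤ m + l + 2e.
--
-- If a triangle abc has deg a, deg b ≥ 3, put the point of ab on c as well, leave the
-- point of bc to c alone and drop the point of ac: a and b keep a third edge point, so
-- this is a representation with one point fewer.  If there is no such triangle, every
-- triangle has two vertices of degree 2; deleting these (keeping the least vertex of each
-- triangle component) leaves a triangle-free G₀ on which G is glued.
--
-- Conversely, if G is almost triangle-free, the standard points inject into the points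
-- of any representation.  An edge of G₀ goes to a common point of its two lines, which
-- lies on no third line.  In a glued triangle {a, s₀, s₁} the edge s₀s₁ goes to a common
-- point of s₀ and s₁, which no other glued vertex passes through, and the edge a sₓ to a
-- point of sₓ off s₁₋ₓ.  Leaves and isolated vertices keep private points.

open import Defs
open import Data.Nat using (ℕ; zero; suc; _+_; _*_; _≤_; z≤n; s≤s; s≤s⁻¹; _≡ᵇ_; _<ᵇ_)
open import Data.Nat.Properties using (≤-trans; ≤-reflexive; 1+n≰n; ≡ᵇ⇒≡; ≡⇒≡ᵇ)
  renaming (suc-injective to ℕ-suc-injective; _≟_ to _≟ℕ_)
open import Data.Fin using (Fin; zero; suc; toℕ; punchIn; punchOut; fromℕ<)
open import Data.Fin.Properties
  using (_≟_; 0≢1+n; suc-injective; toℕ-injective; punchIn-punchOut; any?; injective⇒≤; +↔⊎; *↔×)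
open import Data.Bool using (Bool; true; false; _∧_; _∨_; not; if_then_else_)
open import Data.Bool.Properties
  using (T-≡; ∧-conicalˡ; ∧-conicalʳ; ∧-identityʳ; ∧-zeroʳ; ∧-comm; ∨-zeroʳ; ¬-not; not-injective)
  renaming (_≟_ to _≟ᵇ_)
open import Data.Product using (Σ; ∃; ∃₂; _×_; _,_; proj₁; proj₂)
open import Data.Sum using (_⊎_; inj₁; inj₂)
open import Data.Sum.Properties using (inj₁-injective)
open import Data.Sum.Function.Propositional using (_⊎-↔_)
open import Data.Product.Function.NonDependent.Propositional using (_×-↔_)
open import Data.Empty using (⊥; ⊥-elim)
open import Function using (_∘_)
open import Function.Bundles using (_⇔_; mk⇔; Equivalence; _↔_; Inverse; Injection; mk↔ₛ′)
open import Function.Construct.Composition using (_↔-∘_)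
open import Function.Properties.Inverse using (↔-refl; ↔⇒↣)
open import Relation.Nullary using (¬_; yes; no; Dec; does)
open import Relation.Nullary.Decidable using (dec-true; dec-false; _⊎-dec_; _×-dec_)
open import Axiom.UniquenessOfIdentityProofs using (module Decidable⇒UIP)
open import Relation.Binary.PropositionalEquality as ≡ using (_≡_; _≢_; refl; trans; cong; subst; subst₂)

open Decidable⇒UIP _≟ᵇ_ using () renaming (≡-irrelevant to Bool-UIP)

∧-intro : ∀ {a b} → a ≡ true → b ≡ true → (a ∧ b) ≡ true
∧-intro refl refl = refl

∧-not-elim : ∀ {a b} → (a ∧ not b) ≡ true → (a ≡ true) × (b ≡ false)
∧-not-elim {true} {false} _ = refl , refl

∨-elim : ∀ {a b} → (a ∨ b) ≡ true → (a ≡ true) ⊎ (b ≡ true)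
∨-elim {true}  _ = inj₁ refl
∨-elim {false} p = inj₂ p

does⇒ : ∀ {A : Set} (d : Dec A) → does d ≡ true → A
does⇒ (yes a) _ = a

true≢false : ∀ {b} → b ≡ true → b ≡ false → ⊥
true≢false refl ()

_==_ : ∀ {n} → Fin n → Fin n → Bool
i == j = does (i ≟ j)

==-refl : ∀ {n} (i : Fin n) → (i == i) ≡ true
==-refl i = dec-true (i ≟ i) refl

≢⇒==false : ∀ {n} {i j : Fin n} → i ≢ j → (i == j) ≡ false
≢⇒==false {i = i} {j} = dec-false (i ≟ j)

==⇒≡ : ∀ {n} {i j : Fin n} → (i == j) ≡ true → i ≡ j
==⇒≡ {i = i} {j} = does⇒ (i ≟ j)

==false⇒≢ : ∀ {n} {i j : Fin n} → (i == j) ≡ false → i ≢ j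
==false⇒≢ {i = i} p refl = true≢false (==-refl i) p

≡ᵇ-true⇒≡ : ∀ {m k} → (m ≡ᵇ k) ≡ true → m ≡ k
≡ᵇ-true⇒≡ {m} {k} p = ≡ᵇ⇒≡ m k (Equivalence.from T-≡ p)

≡⇒≡ᵇ-true : ∀ {m k} → m ≡ k → (m ≡ᵇ k) ≡ true
≡⇒≡ᵇ-true {m} {k} m≡k = Equivalence.to T-≡ (≡⇒≡ᵇ m k m≡k)

<ᵇ-asym : ∀ m n → (m <ᵇ n) ≡ true → (n <ᵇ m) ≡ false
<ᵇ-asym zero    (suc n) _   = refl
<ᵇ-asym (suc m) (suc n) m<n = <ᵇ-asym m n m<n

<ᵇ-trans : ∀ l m n → (l <ᵇ m) ≡ true → (m <ᵇ n) ≡ true → (l <ᵇ n) ≡ true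
<ᵇ-trans zero    (suc m) (suc n) _   _   = refl
<ᵇ-trans (suc l) (suc m) (suc n) l<m m<n = <ᵇ-trans l m n l<m m<n

<ᵇ-total : ∀ m n → m ≢ n → ((m <ᵇ n) ≡ true) ⊎ ((n <ᵇ m) ≡ true)
<ᵇ-total zero    zero    m≢n = ⊥-elim (m≢n refl)
<ᵇ-total zero    (suc n) _   = inj₁ refl
<ᵇ-total (suc m) zero    _   = inj₂ refl
<ᵇ-total (suc m) (suc n) m≢n = <ᵇ-total m n (m≢n ∘ cong suc)

<ᵇ-least-of-three : ∀ a b c → a ≢ b → a ≢ c → b ≢ c →
                    ((a <ᵇ b) ∧ (a <ᵇ c)) ≡ true ⊎ ((b <ᵇ a) ∧ (b <ᵇ c)) ≡ true ⊎
                    ((c <ᵇ a) ∧ (c <ᵇ b)) ≡ true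
<ᵇ-least-of-three a b c a≢b a≢c b≢c with <ᵇ-total a b a≢b | <ᵇ-total a c a≢c | <ᵇ-total b c b≢c
... | inj₁ a<b | inj₁ a<c | _        = inj₁ (∧-intro a<b a<c)
... | inj₁ a<b | inj₂ c<a | _        = inj₂ (inj₂ (∧-intro c<a (<ᵇ-trans c a b c<a a<b)))
... | inj₂ b<a | _        | inj₁ b<c = inj₂ (inj₁ (∧-intro b<a b<c))
... | inj₂ b<a | _        | inj₂ c<b = inj₂ (inj₂ (∧-intro (<ᵇ-trans c b a c<b b<a) c<b))

2≤⇒≡2⊎3≤ : ∀ {d} → 2 ≤ d → (d ≡ 2) ⊎ (3 ≤ d)
2≤⇒≡2⊎3≤ {suc zero}          (s≤s ())
2≤⇒≡2⊎3≤ {suc (suc zero)}    _ = inj₁ refl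
2≤⇒≡2⊎3≤ {suc (suc (suc _))} _ = inj₂ (s≤s (s≤s (s≤s z≤n)))

other : Fin 2 → Fin 2
other zero       = suc zero
other (suc zero) = zero

other-≢ : ∀ y → y ≢ other y
other-≢ zero       ()
other-≢ (suc zero) ()

≢⇒other : ∀ {y z : Fin 2} → y ≢ z → z ≡ other y
≢⇒other {zero}     {zero}     y≢z = ⊥-elim (y≢z refl)
≢⇒other {zero}     {suc zero} _   = refl
≢⇒other {suc zero} {zero}     _   = refl
≢⇒other {suc zero} {suc zero} y≢z = ⊥-elim (y≢z refl)

countF-cong : ∀ {n} {f g : Fin n → Bool} → (∀ i → f i ≡ g i) → countF f ≡ countF g
countF-cong {zero}  _   = refl
countF-cong {suc n} f≗g rewrite f≗g zero = cong (_ +_) (countF-cong (f≗g ∘ suc))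

countF-false : ∀ {n} (f : Fin n → Bool) → (∀ i → f i ≡ false) → countF f ≡ 0
countF-false {zero}  f _   = refl
countF-false {suc n} f all rewrite all zero = countF-false (f ∘ suc) (all ∘ suc)

countF≡0⇒false : ∀ {n} (f : Fin n → Bool) → countF f ≡ 0 → ∀ i → f i ≡ false
countF≡0⇒false f c≡0 zero with f zero
... | false = refl
countF≡0⇒false f c≡0 (suc i) with f zero
... | false = countF≡0⇒false (f ∘ suc) c≡0 i

countF-remove : ∀ {n} (f : Fin n → Bool) {x : Fin n} → f x ≡ true →
                countF f ≡ suc (countF (λ i → f i ∧ not (i == x)))
countF-remove f {zero} fx rewrite fx =
  cong suc (countF-cong (λ i → ≡.sym (∧-identityʳ (f (suc i)))))
countF-remove f {suc x} fx with f zero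
... | true  = cong suc (countF-remove (f ∘ suc) fx)
... | false = countF-remove (f ∘ suc) fx

true⇒countF≥1 : ∀ {n} (f : Fin n → Bool) {x} → f x ≡ true → 1 ≤ countF f
true⇒countF≥1 f fx rewrite countF-remove f fx = s≤s z≤n

countF≥2 : ∀ {n} (f : Fin n → Bool) {x y} → f x ≡ true → f y ≡ true → x ≢ y → 2 ≤ countF f
countF≥2 f {x} fx fy x≢y rewrite countF-remove f fx =
  s≤s (true⇒countF≥1 (λ i → f i ∧ not (i == x)) (∧-intro fy (cong not (≢⇒==false (x≢y ∘ ≡.sym)))))

countF≤1 : ∀ {n} (f : Fin n → Bool) → (∀ {x y} → f x ≡ true → f y ≡ true → x ≡ y) → countF f ≤ 1
countF≤1 {zero}  f unique = z≤n
countF≤1 {suc n} f unique with f zero in f0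
... | true  rewrite countF-false (f ∘ suc) (λ i → ¬-not (λ fi → 0≢1+n (unique f0 fi))) = s≤s z≤n
... | false = countF≤1 (f ∘ suc) (λ fx fy → suc-injective (unique fx fy))

countF≤1⇒unique : ∀ {n} (f : Fin n → Bool) → countF f ≤ 1 →
                  ∀ {x y} → f x ≡ true → f y ≡ true → x ≡ y
countF≤1⇒unique f c≤1 {x} {y} fx fy with x ≟ y
... | yes x≡y = x≡y
... | no  x≢y with ≤-trans (countF≥2 f fx fy x≢y) c≤1
...   | s≤s ()

countF-punchIn : ∀ {n} (f : Fin (suc n) → Bool) (z : Fin (suc n)) → f z ≡ false →
                 countF f ≡ countF (f ∘ punchIn z)
countF-punchIn f zero fz rewrite fz = refl
countF-punchIn {suc n} f (suc z) fz with f zero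
... | true  = cong suc (countF-punchIn (f ∘ suc) z fz)
... | false = countF-punchIn (f ∘ suc) z fz

Σ-zero-↔ : (A : Fin 0 → Set) → Fin 0 ↔ Σ (Fin 0) A
Σ-zero-↔ A = mk↔ₛ′ (λ ()) (λ { (() , _) }) (λ { (() , _) }) (λ ())

Σ-suc-↔ : ∀ {n} (A : Fin (suc n) → Set) → (A zero ⊎ Σ (Fin n) (A ∘ suc)) ↔ Σ (Fin (suc n)) A
Σ-suc-↔ {n} A = mk↔ₛ′ to from to∘from from∘to
  where
  to : A zero ⊎ Σ (Fin n) (A ∘ suc) → Σ (Fin (suc n)) A
  to (inj₁ a)       = zero , a
  to (inj₂ (i , a)) = suc i , a
  from : Σ (Fin (suc n)) A → A zero ⊎ Σ (Fin n) (A ∘ suc)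
  from (zero , a)  = inj₁ a
  from (suc i , a) = inj₂ (i , a)
  to∘from : ∀ y → to (from y) ≡ y
  to∘from (zero , a)  = refl
  to∘from (suc i , a) = refl
  from∘to : ∀ x → from (to x) ≡ x
  from∘to (inj₁ a)       = refl
  from∘to (inj₂ (i , a)) = refl

sumF-↔ : ∀ {n} {f : Fin n → ℕ} {A : Fin n → Set} → (∀ i → Fin (f i) ↔ A i) → Fin (sumF f) ↔ Σ (Fin n) A
sumF-↔ {zero}      _ = Σ-zero-↔ _
sumF-↔ {suc n} {f} e = Σ-suc-↔ _ ↔-∘ ((e zero ⊎-↔ sumF-↔ (e ∘ suc)) ↔-∘ +↔⊎ {f zero})

if-↔ : ∀ b → Fin (if b then 1 else 0) ↔ (b ≡ true)
if-↔ true  = mk↔ₛ′ (λ _ → refl) (λ _ → zero) (λ { refl → refl }) (λ { zero → refl })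
if-↔ false = mk↔ₛ′ (λ ()) (λ ()) (λ ()) (λ ())

countF-↔ : ∀ {n} (P : Fin n → Bool) → Fin (countF P) ↔ Σ (Fin n) (λ i → P i ≡ true)
countF-↔ {zero}  P = Σ-zero-↔ _
countF-↔ {suc n} P =
  Σ-suc-↔ _ ↔-∘ ((if-↔ (P zero) ⊎-↔ countF-↔ (P ∘ suc)) ↔-∘ +↔⊎ {if P zero then 1 else 0})

countF≥1⇒∃ : ∀ {n} (f : Fin n → Bool) → 1 ≤ countF f → ∃ λ i → f i ≡ true
countF≥1⇒∃ f c≥1 = Inverse.to (countF-↔ f) (fromℕ< c≥1)

countF-remove₂ : ∀ {n} (f : Fin n → Bool) {b c} → f b ≡ true → f c ≡ true → b ≢ c →
                 countF f ≡ 2 + countF (λ i → (f i ∧ not (i == b)) ∧ not (i == c))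
countF-remove₂ f {b} {c} fb fc b≢c = trans (countF-remove f fb)
  (cong suc (countF-remove (λ i → f i ∧ not (i == b)) (∧-intro fc (cong not (≢⇒==false (b≢c ∘ ≡.sym))))))

countF≥2⇒other : ∀ {n} (f : Fin n → Bool) → 2 ≤ countF f → ∀ {b} → f b ≡ true →
                 ∃ λ d → (f d ≡ true) × (d ≢ b)
countF≥2⇒other f c≥2 {b} fb
  with countF≥1⇒∃ (λ i → f i ∧ not (i == b)) (s≤s⁻¹ (subst (2 ≤_) (countF-remove f fb) c≥2))
... | d , p with ∧-not-elim p
...   | fd , d≠b = d , fd , ==false⇒≢ d≠b

countF≥2⇒∃₂ : ∀ {n} (f : Fin n → Bool) → 2 ≤ countF f →
              ∃₂ λ x y → (f x ≡ true) × (f y ≡ true) × (x ≢ y)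
countF≥2⇒∃₂ f c≥2 with countF≥1⇒∃ f (≤-trans (s≤s z≤n) c≥2)
... | x , fx with countF≥2⇒other f c≥2 fx
...   | y , fy , y≢x = x , y , fx , fy , y≢x ∘ ≡.sym

countF≥3⇒other : ∀ {n} (f : Fin n → Bool) → 3 ≤ countF f →
                 ∀ {b c} → f b ≡ true → f c ≡ true → b ≢ c →
                 ∃ λ d → (f d ≡ true) × (d ≢ b) × (d ≢ c)
countF≥3⇒other f c≥3 {b} {c} fb fc b≢c
  with countF≥1⇒∃ (λ i → (f i ∧ not (i == b)) ∧ not (i == c))
                  (s≤s⁻¹ (s≤s⁻¹ (subst (3 ≤_) (countF-remove₂ f fb fc b≢c) c≥3)))
... | d , p with ∧-not-elim p
...   | q , d≠c with ∧-not-elim q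
...     | fd , d≠b = d , fd , ==false⇒≢ d≠b , ==false⇒≢ d≠c

countF≡2⇒exhaust : ∀ {n} (f : Fin n → Bool) → countF f ≡ 2 →
                   ∀ {b c} → f b ≡ true → f c ≡ true → b ≢ c →
                   ∀ {d} → f d ≡ true → (d ≡ b) ⊎ (d ≡ c)
countF≡2⇒exhaust f c≡2 {b} {c} fb fc b≢c {d} fd with d ≟ b | d ≟ c
... | yes d≡b | _        = inj₁ d≡b
... | no _    | yes d≡c  = inj₂ d≡c
... | no d≢b  | no d≢c   = ⊥-elim (true≢false
  (∧-intro (∧-intro fd (cong not (≢⇒==false d≢b))) (cong not (≢⇒==false d≢c)))
  (countF≡0⇒false _ (ℕ-suc-injective (ℕ-suc-injective
    (trans (≡.sym (countF-remove₂ f fb fc b≢c)) c≡2))) d))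

countF-outside : ∀ {n} (f g : Fin n → Bool) → 2 ≤ countF f → countF (λ i → f i ∧ g i) ≤ 1 →
                 ∃ λ i → (f i ≡ true) × (g i ≡ false)
countF-outside f g c≥2 c≤1 with countF≥2⇒∃₂ f c≥2
... | x , y , fx , fy , x≢y with g x in gx | g y in gy
...   | false | _     = x , fx , gx
...   | true  | false = y , fy , gy
...   | true  | true  = ⊥-elim (x≢y (countF≤1⇒unique _ c≤1 (∧-intro fx gx) (∧-intro fy gy)))

module Enumeration {n : ℕ} (P : Fin n → Bool) where

  enum : Fin (countF P) → Fin n
  enum k = proj₁ (Inverse.to (countF-↔ P) k)

  enum-true : ∀ k → P (enum k) ≡ true
  enum-true k = proj₂ (Inverse.to (countF-↔ P) k)

  index : ∀ i → P i ≡ true → Fin (countF P)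
  index i Pi = Inverse.from (countF-↔ P) (i , Pi)

  enum-index : ∀ i (Pi : P i ≡ true) → enum (index i Pi) ≡ i
  enum-index i Pi = cong proj₁ (Inverse.strictlyInverseˡ (countF-↔ P) (i , Pi))

  index-enum : ∀ k (Pk : P (enum k) ≡ true) → index (enum k) Pk ≡ k
  index-enum k Pk = trans (cong (λ q → index (enum k) q) (Bool-UIP Pk (enum-true k)))
                          (Inverse.strictlyInverseʳ (countF-↔ P) k)

  index-cong : ∀ {i j} (Pi : P i ≡ true) (Pj : P j ≡ true) → i ≡ j → index i Pi ≡ index j Pj
  index-cong Pi Pj refl = cong (index _) (Bool-UIP Pi Pj)

  enum-injective : ∀ {k k′} → enum k ≡ enum k′ → k ≡ k′
  enum-injective {k} {k′} eq =
    trans (≡.sym (index-enum k (enum-true k))) (trans (index-cong _ _ eq) (index-enum k′ (enum-true k′)))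

choose : ∀ {n} → (Fin n → Bool) → Fin n → Fin n
choose P default with any? (λ i → P i ≟ᵇ true)
... | yes (i , _) = i
... | no _        = default

choose-true : ∀ {n} (P : Fin n → Bool) default {i} → P i ≡ true → P (choose P default) ≡ true
choose-true P default {i} Pi with any? (λ i → P i ≟ᵇ true)
... | yes (_ , Pj) = Pj
... | no none      = ⊥-elim (none (i , Pi))

module GraphProperties {n : ℕ} (G : Graph n) where

  infix 4 _~_
  _~_ : Fin n → Fin n → Set
  i ~ j = adj G i j ≡ true

  adj⇒≢ : ∀ {i j} → i ~ j → i ≢ j
  adj⇒≢ {i} aii refl = true≢false aii (irrefl G i)

  adj-sym : ∀ {i j} → i ~ j → j ~ i
  adj-sym {i} {j} aij = trans (Graph.sym G j i) aij

  -- Each edge is stored once, as its ends u < v: exactly what edges G counts.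
  Edge : Set
  Edge = Σ (Fin n) λ u → Σ (Fin n) λ v → ((toℕ u <ᵇ toℕ v) ∧ adj G u v) ≡ true

  edges-↔ : Fin (edges G) ↔ Edge
  edges-↔ = sumF-↔ (λ u → countF-↔ (λ v → (toℕ u <ᵇ toℕ v) ∧ adj G u v))

  data Joins : Edge → Fin n → Fin n → Set where
    forward  : ∀ {u v p} → Joins (u , v , p) u v
    backward : ∀ {u v p} → Joins (u , v , p) v u

  edgeBetween : ∀ {i j} → i ~ j → Σ Edge λ e → Joins e i j
  edgeBetween {i} {j} aij with <ᵇ-total (toℕ i) (toℕ j) (adj⇒≢ aij ∘ toℕ-injective)
  ... | inj₁ i<j = (i , j , ∧-intro i<j aij) , forward
  ... | inj₂ j<i = (j , i , ∧-intro j<i (adj-sym aij)) , backward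

  joins-sym : ∀ {e i j} → Joins e i j → Joins e j i
  joins-sym forward  = backward
  joins-sym backward = forward

  joins-adj : ∀ {e i j} → Joins e i j → i ~ j
  joins-adj {_ , _ , p} forward  = ∧-conicalʳ _ _ p
  joins-adj {_ , _ , p} backward = adj-sym (∧-conicalʳ _ _ p)

  joins-unique : ∀ {e e′ i j} → Joins e i j → Joins e′ i j → e ≡ e′
  joins-unique {u , v , p} {_ , _ , q} forward  forward  = cong (λ r → u , v , r) (Bool-UIP p q)
  joins-unique {u , v , p} {_ , _ , q} backward backward = cong (λ r → u , v , r) (Bool-UIP p q)
  joins-unique {u , v , p} {_ , _ , q} forward  backward =
    ⊥-elim (true≢false (∧-conicalˡ _ _ q) (<ᵇ-asym (toℕ u) (toℕ v) (∧-conicalˡ _ _ p)))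
  joins-unique {u , v , p} {_ , _ , q} backward forward  =
    ⊥-elim (true≢false (∧-conicalˡ _ _ q) (<ᵇ-asym (toℕ u) (toℕ v) (∧-conicalˡ _ _ p)))

  joins-other : ∀ {e i j k} → Joins e i j → Joins e i k → j ≡ k
  joins-other forward  forward  = refl
  joins-other backward backward = refl
  joins-other {_ , _ , p} forward  backward = ⊥-elim (adj⇒≢ (∧-conicalʳ _ _ p) refl)
  joins-other {_ , _ , p} backward forward  = ⊥-elim (adj⇒≢ (∧-conicalʳ _ _ p) refl)

  joins-≢ : ∀ {e e′ i j k} → Joins e i j → Joins e′ i k → j ≢ k → e ≢ e′
  joins-≢ e∼ij e′∼ik j≢k refl = j≢k (joins-other e∼ij e′∼ik)

  joins-within : ∀ {e e′ u v u′ v′} → Joins e u v → Joins e′ u′ v′ →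
                 (u′ ≡ u) ⊎ (u′ ≡ v) → (v′ ≡ u) ⊎ (v′ ≡ v) → e ≡ e′
  joins-within e∼ e′∼ (inj₁ refl) (inj₁ refl) = ⊥-elim (adj⇒≢ (joins-adj e′∼) refl)
  joins-within e∼ e′∼ (inj₁ refl) (inj₂ refl) = joins-unique e∼ e′∼
  joins-within e∼ e′∼ (inj₂ refl) (inj₁ refl) = joins-unique e∼ (joins-sym e′∼)
  joins-within e∼ e′∼ (inj₂ refl) (inj₂ refl) = ⊥-elim (adj⇒≢ (joins-adj e′∼) refl)

  _∈ᵉ_ : Fin n → Edge → Bool
  i ∈ᵉ (u , v , _) = (u == i) ∨ (v == i)

  joins⇒∈ᵉ : ∀ {e i j} → Joins e i j → (i ∈ᵉ e) ≡ true
  joins⇒∈ᵉ {_} {i} forward rewrite ==-refl i = refl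
  joins⇒∈ᵉ {u , _} {i} backward rewrite ==-refl i = ∨-zeroʳ (u == i)

  ∈ᵉ⇒endpoint : ∀ {e i u v} → (i ∈ᵉ e) ≡ true → Joins e u v → (i ≡ u) ⊎ (i ≡ v)
  ∈ᵉ⇒endpoint {u , v , _} {i} i∈e e∼ with ∨-elim {u == i} i∈e | e∼
  ... | inj₁ u=i | forward  = inj₁ (≡.sym (==⇒≡ u=i))
  ... | inj₂ v=i | forward  = inj₂ (≡.sym (==⇒≡ v=i))
  ... | inj₁ u=i | backward = inj₂ (≡.sym (==⇒≡ u=i))
  ... | inj₂ v=i | backward = inj₁ (≡.sym (==⇒≡ v=i))

  ∈ᵉ⇒joins : ∀ {e i j} → (i ∈ᵉ e) ≡ true → (j ∈ᵉ e) ≡ true → i ≢ j → Joins e i j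
  ∈ᵉ⇒joins {u , v , _} {i} {j} i∈e j∈e i≢j with ∨-elim {u == i} i∈e | ∨-elim {u == j} j∈e
  ... | inj₁ u=i | inj₁ u=j = ⊥-elim (i≢j (trans (≡.sym (==⇒≡ {i = u} u=i)) (==⇒≡ u=j)))
  ... | inj₁ u=i | inj₂ v=j rewrite ==⇒≡ {i = u} u=i | ==⇒≡ {i = v} v=j = forward
  ... | inj₂ v=i | inj₁ u=j rewrite ==⇒≡ {i = u} u=j | ==⇒≡ {i = v} v=i = backward
  ... | inj₂ v=i | inj₂ v=j = ⊥-elim (i≢j (trans (≡.sym (==⇒≡ {i = v} v=i)) (==⇒≡ v=j)))

mkRepresentation : ∀ {n p} (G : Graph n) (ℓ : Fin n → Fin p → Bool) →
  (∀ i → ∃₂ λ x y → (ℓ i x ≡ true) × (ℓ i y ≡ true) × (x ≢ y)) →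
  (∀ i j → i ≢ j → ∀ {x y} → (ℓ i x ∧ ℓ j x) ≡ true → (ℓ i y ∧ ℓ j y) ≡ true → x ≡ y) →
  (∀ i j → i ≢ j → (adj G i j ≡ true) ⇔ (∃ λ x → (ℓ i x ∧ ℓ j x) ≡ true)) →
  Representation G p
mkRepresentation G ℓ two unique inter = record
  { lines    = ℓ
  ; distinct = distinct
  ; size≥2   = λ i → let (x , y , ℓx , ℓy , x≢y) = two i in countF≥2 (ℓ i) ℓx ℓy x≢y
  ; linear   = λ i j i≢j → countF≤1 _ (unique i j i≢j)
  ; isInter  = inter
  }
  where
  distinct : ∀ i j → i ≢ j → ¬ (∀ x → ℓ i x ≡ ℓ j x)
  distinct i j i≢j ℓi≗ℓj with two i
  ... | x , y , ℓx , ℓy , x≢y =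
    x≢y (unique i j i≢j (∧-intro ℓx (trans (≡.sym (ℓi≗ℓj x)) ℓx))
                        (∧-intro ℓy (trans (≡.sym (ℓi≗ℓj y)) ℓy)))

removeUnusedPoint : ∀ {n p} {G : Graph n} (R : Representation G (suc p)) (z : Fin (suc p)) →
                    (∀ i → Representation.lines R i z ≡ false) → Representation G p
removeUnusedPoint {n} {p} {G} R z unused = record
  { lines    = ℓ′
  ; distinct = distinct′
  ; size≥2   = λ i → subst (2 ≤_) (countF-punchIn (lines i) z (unused i)) (size≥2 i)
  ; linear   = λ i j i≢j →
                 subst (_≤ 1) (countF-punchIn (λ x → lines i x ∧ lines j x) z (off₂ i j)) (linear i j i≢j)
  ; isInter  = λ i j i≢j →
                 mk⇔ (to i j i≢j) (λ (x , ℓx) → Equivalence.from (isInter i j i≢j) (punchIn z x , ℓx))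
  }
  where
  open Representation R
  ℓ′ : Fin n → Fin p → Bool
  ℓ′ i = lines i ∘ punchIn z
  off₂ : ∀ i j → (lines i z ∧ lines j z) ≡ false
  off₂ i j rewrite unused i = refl
  distinct′ : ∀ i j → i ≢ j → ¬ (∀ x → ℓ′ i x ≡ ℓ′ j x)
  distinct′ i j i≢j ℓ′i≗ℓ′j = distinct i j i≢j ℓi≗ℓj
    where
    ℓi≗ℓj : ∀ y → lines i y ≡ lines j y
    ℓi≗ℓj y with z ≟ y
    ... | yes refl = trans (unused i) (≡.sym (unused j))
    ... | no z≢y = subst (λ w → lines i w ≡ lines j w) (punchIn-punchOut z≢y) (ℓ′i≗ℓ′j (punchOut z≢y))
  to : ∀ i j → i ≢ j → adj G i j ≡ true → ∃ λ x → (ℓ′ i x ∧ ℓ′ j x) ≡ true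
  to i j i≢j aij with Equivalence.to (isInter i j i≢j) aij
  ... | y , ℓy with z ≟ y
  ...   | yes refl = ⊥-elim (true≢false ℓy (off₂ i j))
  ...   | no z≢y =
    punchOut z≢y , subst (λ w → (lines i w ∧ lines j w) ≡ true) (≡.sym (punchIn-punchOut z≢y)) ℓy

unusedPoint⇒¬IsV : ∀ {n N} {G : Graph n} (R : Representation G N) (z : Fin N) →
                   (∀ i → Representation.lines R i z ≡ false) → ¬ IsV G N
unusedPoint⇒¬IsV {N = suc p} R z unused (_ , minimal) = 1+n≰n (minimal p (removeUnusedPoint R z unused))

module RepresentationProperties {n p} {G : Graph n} (R : Representation G p) where
  open Representation R renaming (lines to ℓ)

  meet : ∀ {i j x} → ℓ i x ≡ true → ℓ j x ≡ true → i ≢ j → adj G i j ≡ true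
  meet {i} {j} {x} ℓix ℓjx i≢j = Equivalence.from (isInter i j i≢j) (x , ∧-intro ℓix ℓjx)

  commonPoint : ∀ {i j} → adj G i j ≡ true → ∃ λ x → (ℓ i x ≡ true) × (ℓ j x ≡ true)
  commonPoint {i} {j} aij with Equivalence.to (isInter i j (GraphProperties.adj⇒≢ G aij)) aij
  ... | x , ℓx = x , ∧-conicalˡ _ _ ℓx , ∧-conicalʳ _ _ ℓx

  pointOff : ∀ {i j} → i ≢ j → ∃ λ x → (ℓ i x ≡ true) × (ℓ j x ≡ false)
  pointOff {i} {j} i≢j = countF-outside (ℓ i) (ℓ j) (size≥2 i) (linear i j i≢j)

module Standard {n : ℕ} (G : Graph n) where
  open GraphProperties G

  isLeaf : Fin n → Bool
  isLeaf i = degree G i ≡ᵇ 1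

  isIsolated : Fin n → Bool
  isIsolated i = degree G i ≡ᵇ 0

  leaf-degree : ∀ {i} → isLeaf i ≡ true → degree G i ≡ 1
  leaf-degree = ≡ᵇ-true⇒≡

  isolated-degree : ∀ {i} → isIsolated i ≡ true → degree G i ≡ 0
  isolated-degree = ≡ᵇ-true⇒≡

  Point : Set
  Point = (Edge ⊎ Σ (Fin n) (λ i → isLeaf i ≡ true)) ⊎ (Fin 2 × Σ (Fin n) (λ i → isIsolated i ≡ true))

  pattern edgePoint e         = inj₁ (inj₁ e)
  pattern leafPoint v l       = inj₁ (inj₂ (v , l))
  pattern isolatedPoint b v o = inj₂ (b , (v , o))

  N : ℕ
  N = edges G + leaves G + 2 * isolated G

  points-↔ : Fin N ↔ Point
  points-↔ = ((edges-↔ ⊎-↔ countF-↔ isLeaf) ⊎-↔ (↔-refl ×-↔ countF-↔ isIsolated))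
             ↔-∘ ((+↔⊎ {edges G} ⊎-↔ *↔× {2}) ↔-∘ +↔⊎ {edges G + leaves G})

  -- Opaque, so that unification can recover q from encode q.
  opaque
    encode : Point → Fin N
    encode = Inverse.from points-↔

    decode : Fin N → Point
    decode = Inverse.to points-↔

    decode-encode : ∀ q → decode (encode q) ≡ q
    decode-encode = Inverse.strictlyInverseˡ points-↔

    encode-decode : ∀ x → encode (decode x) ≡ x
    encode-decode = Inverse.strictlyInverseʳ points-↔

  decode-injective : ∀ {x y} → decode x ≡ decode y → x ≡ y
  decode-injective {x} {y} eq = trans (≡.sym (encode-decode x)) (trans (cong encode eq) (encode-decode y))

  encode-injective : ∀ {q r} → encode q ≡ encode r → q ≡ r
  encode-injective {q} {r} eq = trans (≡.sym (decode-encode q)) (trans (cong decode eq) (decode-encode r))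

  _∈ᵖ_ : Fin n → Point → Bool
  i ∈ᵖ edgePoint e           = i ∈ᵉ e
  i ∈ᵖ leafPoint v _         = v == i
  i ∈ᵖ isolatedPoint _ v _   = v == i

  line : Fin n → Fin N → Bool
  line i x = i ∈ᵖ decode x

  line-encode : ∀ i q → line i (encode q) ≡ i ∈ᵖ q
  line-encode i q = cong (i ∈ᵖ_) (decode-encode q)

  line-edgePoint : ∀ {i e j} → Joins e i j → line i (encode (edgePoint e)) ≡ true
  line-edgePoint {i} {e} e∼ij = trans (line-encode i (edgePoint e)) (joins⇒∈ᵉ e∼ij)

  line-leafPoint : ∀ {i} l → line i (encode (leafPoint i l)) ≡ true
  line-leafPoint {i} l = trans (line-encode i (leafPoint i l)) (==-refl i)

  line-isolatedPoint : ∀ {i} b o → line i (encode (isolatedPoint b i o)) ≡ true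
  line-isolatedPoint {i} b o = trans (line-encode i (isolatedPoint b i o)) (==-refl i)

  distinctPoints : ∀ {q r} → q ≢ r → encode q ≢ encode r
  distinctPoints q≢r = q≢r ∘ encode-injective

  distinctEdgePoints : ∀ {e e′} → e ≢ e′ → encode (edgePoint e) ≢ encode (edgePoint e′)
  distinctEdgePoints e≢e′ = distinctPoints (e≢e′ ∘ inj₁-injective ∘ inj₁-injective)

  line-twoPoints : ∀ i → ∃₂ λ x y → (line i x ≡ true) × (line i y ≡ true) × (x ≢ y)
  line-twoPoints i with degree G i in deg
  ... | zero = encode (isolatedPoint zero i o) , encode (isolatedPoint (suc zero) i o) ,
               line-isolatedPoint zero o , line-isolatedPoint (suc zero) o , distinctPoints (λ ())
    where o = ≡⇒≡ᵇ-true deg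
  ... | suc zero with countF≥1⇒∃ (adj G i) (subst (1 ≤_) (≡.sym deg) (s≤s z≤n))
  ...   | j , aij with edgeBetween aij
  ...     | e , e∼ij = encode (edgePoint e) , encode (leafPoint i l) ,
                       line-edgePoint e∼ij , line-leafPoint l , distinctPoints (λ ())
    where l = ≡⇒≡ᵇ-true deg
  line-twoPoints i | suc (suc _) with countF≥2⇒∃₂ (adj G i) (subst (2 ≤_) (≡.sym deg) (s≤s (s≤s z≤n)))
  ...   | j , k , aij , aik , j≢k with edgeBetween aij | edgeBetween aik
  ...     | e , e∼ij | e′ , e′∼ik = encode (edgePoint e) , encode (edgePoint e′) ,
                                    line-edgePoint e∼ij , line-edgePoint e′∼ik ,
                                    distinctEdgePoints (joins-≢ e∼ij e′∼ik j≢k)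

  sharedPoint : ∀ {i j} q → i ≢ j → ((i ∈ᵖ q) ∧ (j ∈ᵖ q)) ≡ true →
                Σ Edge λ e → (q ≡ edgePoint e) × Joins e i j
  sharedPoint (edgePoint e) i≢j both = e , refl , ∈ᵉ⇒joins (∧-conicalˡ _ _ both) (∧-conicalʳ _ _ both) i≢j
  sharedPoint {i} (leafPoint v _) i≢j both =
    ⊥-elim (i≢j (trans (≡.sym (==⇒≡ {i = v} (∧-conicalˡ _ _ both))) (==⇒≡ (∧-conicalʳ (v == i) _ both))))
  sharedPoint {i} (isolatedPoint _ v _) i≢j both =
    ⊥-elim (i≢j (trans (≡.sym (==⇒≡ {i = v} (∧-conicalˡ _ _ both))) (==⇒≡ (∧-conicalʳ (v == i) _ both))))

  line-unique : ∀ i j → i ≢ j → ∀ {x y} → (line i x ∧ line j x) ≡ true →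
                (line i y ∧ line j y) ≡ true → x ≡ y
  line-unique i j i≢j {x} {y} ijx ijy with sharedPoint (decode x) i≢j ijx | sharedPoint (decode y) i≢j ijy
  ... | e , x≡e , e∼ij | e′ , y≡e′ , e′∼ij =
    decode-injective (trans x≡e (trans (cong edgePoint (joins-unique e∼ij e′∼ij)) (≡.sym y≡e′)))

  line-inter : ∀ i j → i ≢ j → (i ~ j) ⇔ (∃ λ x → (line i x ∧ line j x) ≡ true)
  line-inter i j i≢j = mk⇔ to from
    where
    to : i ~ j → ∃ λ x → (line i x ∧ line j x) ≡ true
    to aij = let (e , e∼ij) = edgeBetween aij in
             encode (edgePoint e) , ∧-intro (line-edgePoint e∼ij) (line-edgePoint (joins-sym e∼ij))
    from : (∃ λ x → (line i x ∧ line j x) ≡ true) → i ~ j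
    from (x , ijx) = let (_ , _ , e∼ij) = sharedPoint (decode x) i≢j ijx in joins-adj e∼ij

  standard : Representation G N
  standard = mkRepresentation G line line-twoPoints line-unique line-inter

-- A triangle with two vertices of degree at least 3

module HeavyTriangle {n : ℕ} (G : Graph n) {a b c : Fin n}
  (ab : adj G a b ≡ true) (bc : adj G b c ≡ true) (ac : adj G a c ≡ true)
  (3≤deg-a : 3 ≤ degree G a) (3≤deg-b : 3 ≤ degree G b) where

  open GraphProperties G
  open Standard G

  OnTriangle : Fin n → Set
  OnTriangle i = (i ≡ a) ⊎ (i ≡ b) ⊎ (i ≡ c)

  onTriangle? : ∀ i → Dec (OnTriangle i)
  onTriangle? i = (i ≟ a) ⊎-dec (i ≟ b) ⊎-dec (i ≟ c)

  triangle-adj : ∀ {i j} → OnTriangle i → OnTriangle j → i ≢ j → i ~ j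
  triangle-adj (inj₁ refl)        (inj₁ refl)        i≢j = ⊥-elim (i≢j refl)
  triangle-adj (inj₁ refl)        (inj₂ (inj₁ refl)) _   = ab
  triangle-adj (inj₁ refl)        (inj₂ (inj₂ refl)) _   = ac
  triangle-adj (inj₂ (inj₁ refl)) (inj₁ refl)        _   = adj-sym ab
  triangle-adj (inj₂ (inj₁ refl)) (inj₂ (inj₁ refl)) i≢j = ⊥-elim (i≢j refl)
  triangle-adj (inj₂ (inj₁ refl)) (inj₂ (inj₂ refl)) _   = bc
  triangle-adj (inj₂ (inj₂ refl)) (inj₁ refl)        _   = adj-sym ac
  triangle-adj (inj₂ (inj₂ refl)) (inj₂ (inj₁ refl)) _   = adj-sym bc
  triangle-adj (inj₂ (inj₂ refl)) (inj₂ (inj₂ refl)) i≢j = ⊥-elim (i≢j refl)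

  eab eac ebc : Edge
  eab = proj₁ (edgeBetween ab)
  eac = proj₁ (edgeBetween ac)
  ebc = proj₁ (edgeBetween bc)

  eab∼ : Joins eab a b
  eab∼ = proj₂ (edgeBetween ab)
  eac∼ : Joins eac a c
  eac∼ = proj₂ (edgeBetween ac)
  ebc∼ : Joins ebc b c
  ebc∼ = proj₂ (edgeBetween bc)

  xab xac xbc : Fin N
  xab = encode (edgePoint eab)
  xac = encode (edgePoint eac)
  xbc = encode (edgePoint ebc)

  TrianglePoint : Fin N → Set
  TrianglePoint x = (x ≡ xab) ⊎ (x ≡ xac) ⊎ (x ≡ xbc)

  xab≢xac : xab ≢ xac
  xab≢xac = distinctEdgePoints (joins-≢ eab∼ eac∼ (adj⇒≢ bc))

  xab≢xbc : xab ≢ xbc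
  xab≢xbc = distinctEdgePoints (joins-≢ (joins-sym eab∼) ebc∼ (adj⇒≢ ac))

  xac≢xbc : xac ≢ xbc
  xac≢xbc = distinctEdgePoints (joins-≢ (joins-sym eac∼) (joins-sym ebc∼) (adj⇒≢ ab))

  a-on : OnTriangle a
  a-on = inj₁ refl
  b-on : OnTriangle b
  b-on = inj₂ (inj₁ refl)
  c-on : OnTriangle c
  c-on = inj₂ (inj₂ refl)

  trianglePoint? : ∀ x → Dec (TrianglePoint x)
  trianglePoint? x = (x ≟ xab) ⊎-dec (x ≟ xac) ⊎-dec (x ≟ xbc)

  samePoint : ∀ {e e′ i j} → Joins e i j → Joins e′ i j → encode (edgePoint e) ≡ encode (edgePoint e′)
  samePoint e∼ e′∼ = cong (encode ∘ edgePoint) (joins-unique e∼ e′∼)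

  triangleEdgePoint : ∀ {e i j} → Joins e i j → OnTriangle i → OnTriangle j →
                      TrianglePoint (encode (edgePoint e))
  triangleEdgePoint e∼ (inj₁ refl)        (inj₁ refl)        = ⊥-elim (adj⇒≢ (joins-adj e∼) refl)
  triangleEdgePoint e∼ (inj₁ refl)        (inj₂ (inj₁ refl)) = inj₁ (samePoint e∼ eab∼)
  triangleEdgePoint e∼ (inj₁ refl)        (inj₂ (inj₂ refl)) = inj₂ (inj₁ (samePoint e∼ eac∼))
  triangleEdgePoint e∼ (inj₂ (inj₁ refl)) (inj₁ refl)        = inj₁ (samePoint e∼ (joins-sym eab∼))
  triangleEdgePoint e∼ (inj₂ (inj₁ refl)) (inj₂ (inj₁ refl)) = ⊥-elim (adj⇒≢ (joins-adj e∼) refl)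
  triangleEdgePoint e∼ (inj₂ (inj₁ refl)) (inj₂ (inj₂ refl)) = inj₂ (inj₂ (samePoint e∼ ebc∼))
  triangleEdgePoint e∼ (inj₂ (inj₂ refl)) (inj₁ refl)        = inj₂ (inj₁ (samePoint e∼ (joins-sym eac∼)))
  triangleEdgePoint e∼ (inj₂ (inj₂ refl)) (inj₂ (inj₁ refl)) = inj₂ (inj₂ (samePoint e∼ (joins-sym ebc∼)))
  triangleEdgePoint e∼ (inj₂ (inj₂ refl)) (inj₂ (inj₂ refl)) = ⊥-elim (adj⇒≢ (joins-adj e∼) refl)

  onTriangle-endpoint : ∀ {i e u v} → line i (encode (edgePoint e)) ≡ true → Joins e u v →
                        OnTriangle u → OnTriangle v → OnTriangle i
  onTriangle-endpoint {i} {e} ℓi e∼ u-on v-on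
    with ∈ᵉ⇒endpoint (trans (≡.sym (line-encode i (edgePoint e))) ℓi) e∼
  ... | inj₁ refl = u-on
  ... | inj₂ refl = v-on

  line-trianglePoint : ∀ {i x} → line i x ≡ true → TrianglePoint x → OnTriangle i
  line-trianglePoint ℓi (inj₁ refl)        = onTriangle-endpoint ℓi eab∼ a-on b-on
  line-trianglePoint ℓi (inj₂ (inj₁ refl)) = onTriangle-endpoint ℓi eac∼ a-on c-on
  line-trianglePoint ℓi (inj₂ (inj₂ refl)) = onTriangle-endpoint ℓi ebc∼ b-on c-on

  sharedPoint-trianglePoint : ∀ {i j y} → i ≢ j → OnTriangle i → OnTriangle j →
                              (line i y ∧ line j y) ≡ true → TrianglePoint y
  sharedPoint-trianglePoint {y = y} i≢j i-on j-on ijy with sharedPoint (decode y) i≢j ijy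
  ... | e , y≡e , e∼ = subst TrianglePoint (trans (cong encode (≡.sym y≡e)) (encode-decode y))
                             (triangleEdgePoint e∼ i-on j-on)

  mergedLine : Fin n → Fin N → Bool
  mergedLine i x = if x == xac then false
                   else if x == xbc then i == c
                   else if x == xab then does (onTriangle? i)
                   else line i x

  mergedLine-xac : ∀ i → mergedLine i xac ≡ false
  mergedLine-xac i rewrite ==-refl xac = refl

  mergedLine-xbc : ∀ i → mergedLine i xbc ≡ (i == c)
  mergedLine-xbc i rewrite ≢⇒==false (xac≢xbc ∘ ≡.sym) | ==-refl xbc = refl

  mergedLine-xab : ∀ i → mergedLine i xab ≡ does (onTriangle? i)
  mergedLine-xab i rewrite ≢⇒==false xab≢xac | ≢⇒==false xab≢xbc | ==-refl xab = refl

  mergedLine-other : ∀ {i x} → ¬ TrianglePoint x → mergedLine i x ≡ line i x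
  mergedLine-other {i} {x} off
    rewrite ≢⇒==false (off ∘ inj₂ ∘ inj₁) | ≢⇒==false (off ∘ inj₂ ∘ inj₂) | ≢⇒==false (off ∘ inj₁)
    = refl

  mergedLine-xab-on : ∀ {i} → OnTriangle i → mergedLine i xab ≡ true
  mergedLine-xab-on {i} i-on = trans (mergedLine-xab i) (dec-true (onTriangle? i) i-on)

  extraPoint : ∀ {u v w} → u ~ v → u ~ w → v ≢ w → 3 ≤ degree G u →
               (∀ {d} → OnTriangle d → (d ≡ u) ⊎ (d ≡ v) ⊎ (d ≡ w)) →
               ∃ λ y → (mergedLine u y ≡ true) × (y ≢ xab)
  extraPoint {u} uv uw v≢w 3≤deg cover with countF≥3⇒other (adj G u) 3≤deg uv uw v≢w
  ... | d , ud , d≢v , d≢w with edgeBetween ud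
  ...   | e , e∼ = encode (edgePoint e) , trans (mergedLine-other off) (line-edgePoint e∼) , off ∘ inj₁
    where
    d-off : ¬ OnTriangle d
    d-off d-on with cover d-on
    ... | inj₁ d≡u        = adj⇒≢ ud (≡.sym d≡u)
    ... | inj₂ (inj₁ d≡v) = d≢v d≡v
    ... | inj₂ (inj₂ d≡w) = d≢w d≡w
    off : ¬ TrianglePoint (encode (edgePoint e))
    off = d-off ∘ line-trianglePoint (line-edgePoint (joins-sym e∼))

  mergedLine-twoPoints : ∀ i → ∃₂ λ x y → (mergedLine i x ≡ true) × (mergedLine i y ≡ true) × (x ≢ y)
  mergedLine-twoPoints i with onTriangle? i
  ... | yes (inj₁ refl) =
    let (y , ℓy , y≢xab) = extraPoint ab ac (adj⇒≢ bc) 3≤deg-a (λ d-on → d-on)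
    in xab , y , mergedLine-xab-on a-on , ℓy , y≢xab ∘ ≡.sym
  ... | yes (inj₂ (inj₁ refl)) =
    let (y , ℓy , y≢xab) = extraPoint (adj-sym ab) bc (adj⇒≢ ac) 3≤deg-b
                             λ { (inj₁ d≡a)        → inj₂ (inj₁ d≡a)
                               ; (inj₂ (inj₁ d≡b)) → inj₁ d≡b
                               ; (inj₂ (inj₂ d≡c)) → inj₂ (inj₂ d≡c) }
    in xab , y , mergedLine-xab-on b-on , ℓy , y≢xab ∘ ≡.sym
  ... | yes (inj₂ (inj₂ refl)) = xab , xbc , mergedLine-xab-on c-on , trans (mergedLine-xbc c) (==-refl c) , xab≢xbc
  ... | no i-off =
    let (x , y , ℓx , ℓy , x≢y) = line-twoPoints i
    in x , y , trans (mergedLine-other (i-off ∘ line-trianglePoint ℓx)) ℓx ,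
               trans (mergedLine-other (i-off ∘ line-trianglePoint ℓy)) ℓy , x≢y

  data Shared (i j : Fin n) (x : Fin N) : Set where
    atMerged  : x ≡ xab → OnTriangle i → OnTriangle j → Shared i j x
    elsewhere : ¬ TrianglePoint x → (line i x ∧ line j x) ≡ true → Shared i j x

  shared : ∀ {i j} → i ≢ j → ∀ x → (mergedLine i x ∧ mergedLine j x) ≡ true → Shared i j x
  shared {i} {j} i≢j x ij with trianglePoint? x
  ... | no off = elsewhere off (subst₂ (λ p q → (p ∧ q) ≡ true) (mergedLine-other off) (mergedLine-other off) ij)
  ... | yes (inj₁ refl) =
    atMerged refl (does⇒ (onTriangle? i) (trans (≡.sym (mergedLine-xab i)) (∧-conicalˡ _ _ ij)))
                  (does⇒ (onTriangle? j) (trans (≡.sym (mergedLine-xab j)) (∧-conicalʳ _ _ ij)))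
  ... | yes (inj₂ (inj₁ refl)) = ⊥-elim (true≢false (∧-conicalˡ _ _ ij) (mergedLine-xac i))
  ... | yes (inj₂ (inj₂ refl)) =
    ⊥-elim (i≢j (trans (==⇒≡ (trans (≡.sym (mergedLine-xbc i)) (∧-conicalˡ _ _ ij)))
                       (≡.sym (==⇒≡ (trans (≡.sym (mergedLine-xbc j)) (∧-conicalʳ _ _ ij))))))

  mergedLine-unique : ∀ i j → i ≢ j → ∀ {x y} → (mergedLine i x ∧ mergedLine j x) ≡ true →
                      (mergedLine i y ∧ mergedLine j y) ≡ true → x ≡ y
  mergedLine-unique i j i≢j {x} {y} ijx ijy with shared i≢j x ijx | shared i≢j y ijy
  ... | atMerged x≡xab _ _   | atMerged y≡xab _ _   = trans x≡xab (≡.sym y≡xab)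
  ... | elsewhere _ ijx′     | elsewhere _ ijy′     = line-unique i j i≢j ijx′ ijy′
  ... | atMerged _ i-on j-on | elsewhere off ijy′   = ⊥-elim (off (sharedPoint-trianglePoint i≢j i-on j-on ijy′))
  ... | elsewhere off ijx′   | atMerged _ i-on j-on = ⊥-elim (off (sharedPoint-trianglePoint i≢j i-on j-on ijx′))

  mergedLine-inter : ∀ i j → i ≢ j → (i ~ j) ⇔ (∃ λ x → (mergedLine i x ∧ mergedLine j x) ≡ true)
  mergedLine-inter i j i≢j = mk⇔ to from
    where
    to : i ~ j → ∃ λ x → (mergedLine i x ∧ mergedLine j x) ≡ true
    to aij with Equivalence.to (line-inter i j i≢j) aij
    ... | x , ijx with trianglePoint? x
    ...   | yes t = xab , ∧-intro (mergedLine-xab-on (line-trianglePoint (∧-conicalˡ _ _ ijx) t))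
                                  (mergedLine-xab-on (line-trianglePoint (∧-conicalʳ _ _ ijx) t))
    ...   | no off = x , subst₂ (λ p q → (p ∧ q) ≡ true)
                                (≡.sym (mergedLine-other off)) (≡.sym (mergedLine-other off)) ijx
    from : (∃ λ x → (mergedLine i x ∧ mergedLine j x) ≡ true) → i ~ j
    from (x , ijx) with shared i≢j x ijx
    ... | atMerged _ i-on j-on = triangle-adj i-on j-on i≢j
    ... | elsewhere _ ijx′     = Equivalence.from (line-inter i j i≢j) (x , ijx′)

  merged : Representation G N
  merged = mkRepresentation G mergedLine mergedLine-twoPoints mergedLine-unique mergedLine-inter

  ¬IsV : ¬ IsV G N
  ¬IsV = unusedPoint⇒¬IsV merged xac mergedLine-xac

NoHeavyTriangle : ∀ {n} → Graph n → Set
NoHeavyTriangle G = ∀ a b c → adj G a b ≡ true → adj G b c ≡ true → adj G a c ≡ true →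
                    3 ≤ degree G a → 3 ≤ degree G b → ⊥

isV⇒noHeavyTriangle : ∀ {n} (G : Graph n) → IsV G (Standard.N G) → NoHeavyTriangle G
isV⇒noHeavyTriangle G isV a b c ab bc ac 3≤deg-a 3≤deg-b = HeavyTriangle.¬IsV G ab bc ac 3≤deg-a 3≤deg-b isV

-- Graphs without such triangles are almost triangle-free

module Decomposition {n : ℕ} (G : Graph n) (noHeavy : NoHeavyTriangle G) where

  open GraphProperties G

  Triangle : Fin n → Fin n → Fin n → Set
  Triangle x y z = (x ~ y) × (x ~ z) × (y ~ z)

  triangle? : ∀ x y z → Dec (Triangle x y z)
  triangle? x y z = (adj G x y ≟ᵇ true) ×-dec (adj G x z ≟ᵇ true) ×-dec (adj G y z ≟ᵇ true)

  triangle-deg≥2 : ∀ {x y z} → Triangle x y z → 2 ≤ degree G x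
  triangle-deg≥2 (xy , xz , yz) = countF≥2 (adj G _) xy xz (adj⇒≢ yz)

  deg2-neighbours : ∀ {x y z} → degree G x ≡ 2 → Triangle x y z → ∀ {w} → x ~ w → (w ≡ y) ⊎ (w ≡ z)
  deg2-neighbours deg≡2 (xy , xz , yz) = countF≡2⇒exhaust (adj G _) deg≡2 xy xz (adj⇒≢ yz)

  deg2-triangle : ∀ {x y z} → degree G x ≡ 2 → Triangle x y z →
                  ∀ {w w′} → x ~ w → x ~ w′ → w ≢ w′ → w ~ w′
  deg2-triangle deg≡2 t@(_ , _ , yz) xw xw′ w≢w′ with deg2-neighbours deg≡2 t xw | deg2-neighbours deg≡2 t xw′
  ... | inj₁ refl | inj₁ refl = ⊥-elim (w≢w′ refl)
  ... | inj₁ refl | inj₂ refl = yz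
  ... | inj₂ refl | inj₁ refl = adj-sym yz
  ... | inj₂ refl | inj₂ refl = ⊥-elim (w≢w′ refl)

  forced-deg2 : ∀ {x y z} → Triangle x y z → (degree G y ≡ᵇ 2) ≡ false → degree G z ≡ 2
  forced-deg2 {x} {y} {z} (xy , xz , yz) y≢2 with 2≤⇒≡2⊎3≤ (triangle-deg≥2 (adj-sym xz , adj-sym yz , xy))
  ... | inj₁ deg≡2 = deg≡2
  ... | inj₂ 3≤deg-z with 2≤⇒≡2⊎3≤ (triangle-deg≥2 (adj-sym xy , yz , xz))
  ...   | inj₁ deg≡2 = ⊥-elim (true≢false (≡⇒≡ᵇ-true deg≡2) y≢2)
  ...   | inj₂ 3≤deg-y = ⊥-elim (noHeavy y z x yz (adj-sym xz) (adj-sym xy) 3≤deg-y 3≤deg-z)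

  is2 : Fin n → Bool
  is2 x = degree G x ≡ᵇ 2

  _≺_ : Fin n → Fin n → Bool
  x ≺ y = is2 y ∧ (toℕ x <ᵇ toℕ y)

  -- In a triangle component (all degrees 2) only the least vertex, its root, survives in G₀.
  isRoot : Fin n → Fin n → Fin n → Bool
  isRoot x y z = (x ≺ y) ∧ (x ≺ z)

  isRoot-cong : ∀ {x y z y′ z′} → degree G x ≡ 2 → Triangle x y z → x ~ y′ → x ~ z′ → y′ ≢ z′ →
                isRoot x y z ≡ isRoot x y′ z′
  isRoot-cong {x} deg≡2 t xy′ xz′ y′≢z′ with deg2-neighbours deg≡2 t xy′ | deg2-neighbours deg≡2 t xz′
  ... | inj₁ refl | inj₁ refl = ⊥-elim (y′≢z′ refl)
  ... | inj₁ refl | inj₂ refl = refl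
  ... | inj₂ refl | inj₁ refl = ∧-comm (x ≺ _) _
  ... | inj₂ refl | inj₂ refl = ⊥-elim (y′≢z′ refl)

  root⇒is2 : ∀ {x y z} → isRoot x y z ≡ true → is2 y ≡ true
  root⇒is2 {x} {y} {z} root = ∧-conicalˡ (is2 y) _ (∧-conicalˡ (x ≺ y) (x ≺ z) root)

  root⇒< : ∀ {x y z} → isRoot x y z ≡ true → (toℕ x <ᵇ toℕ y) ≡ true
  root⇒< {x} {y} {z} root = ∧-conicalʳ (is2 y) _ (∧-conicalˡ (x ≺ y) (x ≺ z) root)

  not-rootʳ : ∀ {x y z} → (x ≺ z) ≡ false → isRoot x y z ≡ false
  not-rootʳ {x} {y} x⊀z rewrite x⊀z = ∧-zeroʳ (x ≺ y)

  ⊀-not2 : ∀ {x y} → is2 y ≡ false → (x ≺ y) ≡ false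
  ⊀-not2 y≢2 rewrite y≢2 = refl

  ⊀-larger : ∀ {x y} → (toℕ y <ᵇ toℕ x) ≡ true → (x ≺ y) ≡ false
  ⊀-larger {x} {y} y<x rewrite <ᵇ-asym (toℕ y) (toℕ x) y<x = ∧-zeroʳ (is2 y)

  root-exists : ∀ {x y z} → is2 x ≡ true → is2 y ≡ true → is2 z ≡ true → Triangle x y z →
                isRoot x y z ≡ true ⊎ isRoot y x z ≡ true ⊎ isRoot z x y ≡ true
  root-exists {x} {y} {z} x2 y2 z2 (xy , xz , yz) rewrite x2 | y2 | z2 =
    <ᵇ-least-of-three (toℕ x) (toℕ y) (toℕ z)
      (adj⇒≢ xy ∘ toℕ-injective) (adj⇒≢ xz ∘ toℕ-injective) (adj⇒≢ yz ∘ toℕ-injective)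

  Removed : Fin n → Set
  Removed x = (degree G x ≡ 2) × ∃₂ λ y z → Triangle x y z × (isRoot x y z ≡ false)

  removed? : ∀ x → Dec (Removed x)
  removed? x = degree G x ≟ℕ 2 ×-dec any? λ y → any? λ z → triangle? x y z ×-dec (isRoot x y z ≟ᵇ false)

  opaque
    removed : Fin n → Bool
    removed x = does (removed? x)

    removed-deg : ∀ {x} → removed x ≡ true → degree G x ≡ 2
    removed-deg {x} rx = proj₁ (does⇒ (removed? x) rx)

    removed-triangle : ∀ {x} → removed x ≡ true → ∃₂ λ y z → Triangle x y z
    removed-triangle {x} rx = let (_ , y , z , t , _) = does⇒ (removed? x) rx in y , z , t

    mkRemoved : ∀ {x y z} → degree G x ≡ 2 → Triangle x y z → isRoot x y z ≡ false → removed x ≡ true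
    mkRemoved {x} deg≡2 t notRoot = dec-true (removed? x) (deg≡2 , _ , _ , t , notRoot)

    removed-notRoot : ∀ {x y z} → removed x ≡ true → Triangle x y z → isRoot x y z ≡ false
    removed-notRoot {x} rx (xy , xz , yz) with does⇒ (removed? x) rx
    ... | deg≡2 , _ , _ , t′ , notRoot = trans (≡.sym (isRoot-cong deg≡2 t′ xy xz (adj⇒≢ yz))) notRoot

  kept : Fin n → Bool
  kept x = not (removed x)

  kept-root : ∀ {x y z} → kept x ≡ true → degree G x ≡ 2 → Triangle x y z → isRoot x y z ≡ true
  kept-root {x} {y} {z} kx deg≡2 t with isRoot x y z in root
  ... | true  = refl
  ... | false = ⊥-elim (true≢false (mkRemoved deg≡2 t root) (not-injective kx))

  kept⊎removed : ∀ x → (kept x ≡ true) ⊎ (removed x ≡ true)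
  kept⊎removed x with removed x
  ... | true  = inj₂ refl
  ... | false = inj₁ refl

  kept≢removed : ∀ {y z} → kept y ≡ true → removed z ≡ true → y ≢ z
  kept≢removed ky rz refl = true≢false rz (not-injective ky)

  is2⇒deg : ∀ {x} → is2 x ≡ true → degree G x ≡ 2
  is2⇒deg = ≡ᵇ-true⇒≡

  removed-is2 : ∀ {x} → removed x ≡ true → is2 x ≡ true
  removed-is2 = ≡⇒≡ᵇ-true ∘ removed-deg

  removedNeighbour : ∀ {x} → removed x ≡ true → ∃ λ y → (x ~ y) × (removed y ≡ true)
  removedNeighbour rx with removed-triangle rx
  ... | y , z , t@(xy , xz , yz) with is2 y in y2 | is2 z in z2
  ...   | false | _    = z , xz , mkRemoved (forced-deg2 t y2) (adj-sym xz , adj-sym yz , xy) (not-rootʳ (⊀-not2 y2))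
  ...   | true  | false =
    y , xy , mkRemoved (forced-deg2 (xz , xy , adj-sym yz) z2) (adj-sym xy , yz , xz) (not-rootʳ (⊀-not2 z2))
  ...   | true  | true with <ᵇ-total (toℕ y) (toℕ z) (adj⇒≢ yz ∘ toℕ-injective)
  ...     | inj₁ y<z = z , xz , mkRemoved (is2⇒deg z2) (adj-sym xz , adj-sym yz , xy) (not-rootʳ (⊀-larger y<z))
  ...     | inj₂ z<y = y , xy , mkRemoved (is2⇒deg y2) (adj-sym xy , yz , xz) (not-rootʳ (⊀-larger z<y))

  removedNeighbour-unique : ∀ {x y y′} → removed x ≡ true →
                            x ~ y → removed y ≡ true → x ~ y′ → removed y′ ≡ true → y ≡ y′
  removedNeighbour-unique {x} {y} {y′} rx xy ry xy′ ry′ with y ≟ y′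
  ... | yes y≡y′ = y≡y′
  ... | no y≢y′ with removed-triangle rx
  ...   | _ , _ , t with deg2-triangle (removed-deg rx) t xy xy′ y≢y′
  ...     | yy′ with root-exists (removed-is2 rx) (removed-is2 ry) (removed-is2 ry′) (xy , xy′ , yy′)
  ...       | inj₁ root        = ⊥-elim (true≢false root (removed-notRoot rx (xy , xy′ , yy′)))
  ...       | inj₂ (inj₁ root) = ⊥-elim (true≢false root (removed-notRoot ry (adj-sym xy , yy′ , xy′)))
  ...       | inj₂ (inj₂ root) = ⊥-elim (true≢false root (removed-notRoot ry′ (adj-sym xy′ , adj-sym yy′ , xy)))

  keptNeighbour : ∀ {x} → removed x ≡ true → ∃ λ y → (x ~ y) × (kept y ≡ true)
  keptNeighbour rx with removed-triangle rx
  ... | y , z , (xy , xz , yz) with kept⊎removed y | kept⊎removed z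
  ...   | inj₁ ky | _       = y , xy , ky
  ...   | inj₂ _  | inj₁ kz = z , xz , kz
  ...   | inj₂ ry | inj₂ rz = ⊥-elim (adj⇒≢ yz (removedNeighbour-unique rx xy ry xz rz))

  opaque
    mate hub : Fin n → Fin n
    mate x = choose (λ y → adj G x y ∧ removed y) x
    hub x  = choose (λ y → adj G x y ∧ kept y) x

    mate-spec : ∀ {x} → removed x ≡ true → (x ~ mate x) × (removed (mate x) ≡ true)
    mate-spec {x} rx =
      let (y , xy , ry) = removedNeighbour rx
          m = choose-true (λ y → adj G x y ∧ removed y) x (∧-intro xy ry)
      in ∧-conicalˡ (adj G x (mate x)) _ m , ∧-conicalʳ (adj G x (mate x)) _ m

    hub-spec : ∀ {x} → removed x ≡ true → (x ~ hub x) × (kept (hub x) ≡ true)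
    hub-spec {x} rx =
      let (y , xy , ky) = keptNeighbour rx
          h = choose-true (λ y → adj G x y ∧ kept y) x (∧-intro xy ky)
      in ∧-conicalˡ (adj G x (hub x)) _ h , ∧-conicalʳ (adj G x (hub x)) _ h

  mate-unique : ∀ {x y} → removed x ≡ true → x ~ y → removed y ≡ true → y ≡ mate x
  mate-unique rx xy ry = removedNeighbour-unique rx xy ry (proj₁ (mate-spec rx)) (proj₂ (mate-spec rx))

  mate-involutive : ∀ {x} → removed x ≡ true → mate (mate x) ≡ x
  mate-involutive rx = let (xm , rm) = mate-spec rx in ≡.sym (mate-unique rm (adj-sym xm) rx)

  hub-mate-triangle : ∀ {x} → removed x ≡ true → Triangle x (hub x) (mate x)
  hub-mate-triangle rx with removed-triangle rx | hub-spec rx | mate-spec rx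
  ... | _ , _ , t | xh , kh | xm , rm = xh , xm , deg2-triangle (removed-deg rx) t xh xm (kept≢removed kh rm)

  hub-unique : ∀ {x w} → removed x ≡ true → x ~ w → kept w ≡ true → w ≡ hub x
  hub-unique rx xw kw with deg2-neighbours (removed-deg rx) (hub-mate-triangle rx) xw
  ... | inj₁ w≡hub = w≡hub
  ... | inj₂ w≡mate = ⊥-elim (kept≢removed kw (proj₂ (mate-spec rx)) w≡mate)

  hub-mate : ∀ {x} → removed x ≡ true → hub (mate x) ≡ hub x
  hub-mate rx = let (_ , _ , hm) = hub-mate-triangle rx in
                ≡.sym (hub-unique (proj₂ (mate-spec rx)) (adj-sym hm) (proj₂ (hub-spec rx)))

  kept-deg2-triangle : ∀ {u v w} → kept u ≡ true → kept v ≡ true → Triangle u v w → degree G u ≡ 2 → ⊥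
  kept-deg2-triangle {u} {v} ku kv t@(uv , uw , vw) deg≡2 =
    let root-u = kept-root ku deg≡2 t
        root-v = kept-root kv (is2⇒deg (root⇒is2 root-u)) (adj-sym uv , vw , uw)
    in true≢false (root⇒< root-v) (<ᵇ-asym (toℕ u) (toℕ v) (root⇒< root-u))

  kept-triangleFree : ∀ {a b c} → kept a ≡ true → kept b ≡ true → kept c ≡ true →
                      a ~ b → b ~ c → a ~ c → ⊥
  kept-triangleFree {a} {b} {c} ka kb kc ab bc ac with 2≤⇒≡2⊎3≤ (triangle-deg≥2 (ab , ac , bc))
  ... | inj₁ deg-a≡2 = kept-deg2-triangle ka kb (ab , ac , bc) deg-a≡2
  ... | inj₂ 3≤deg-a with 2≤⇒≡2⊎3≤ (triangle-deg≥2 (adj-sym ab , bc , ac))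
  ...   | inj₁ deg-b≡2 = kept-deg2-triangle kb ka (adj-sym ab , bc , ac) deg-b≡2
  ...   | inj₂ 3≤deg-b = noHeavy a b c ab bc ac 3≤deg-a 3≤deg-b

  -- A glued triangle is indexed by the smaller of its two removed vertices.
  first : Fin n → Bool
  first x = removed x ∧ (toℕ x <ᵇ toℕ (mate x))

  module K = Enumeration kept
  module F = Enumeration first

  n₀ t : ℕ
  n₀ = countF kept
  t  = countF first

  G₀ : Graph n₀
  G₀ = record
    { adj    = λ a b → adj G (K.enum a) (K.enum b)
    ; sym    = λ a b → Graph.sym G (K.enum a) (K.enum b)
    ; irrefl = λ a → irrefl G (K.enum a)
    }

  G₀-triangleFree : TriangleFree G₀
  G₀-triangleFree a b c = kept-triangleFree (K.enum-true a) (K.enum-true b) (K.enum-true c)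

  first-removed : ∀ s → removed (F.enum s) ≡ true
  first-removed s = ∧-conicalˡ _ _ (F.enum-true s)

  first-< : ∀ s → (toℕ (F.enum s) <ᵇ toℕ (mate (F.enum s))) ≡ true
  first-< s = ∧-conicalʳ (removed (F.enum s)) _ (F.enum-true s)

  mate-first : ∀ {x} → kept x ≡ false → first x ≡ false → first (mate x) ≡ true
  mate-first {x} kx fx with not-injective kx
  ... | rx rewrite rx with mate-spec rx
  ...   | xm , rm rewrite mate-involutive rx | rm
          with <ᵇ-total (toℕ (mate x)) (toℕ x) (adj⇒≢ xm ∘ ≡.sym ∘ toℕ-injective)
  ...     | inj₁ m<x = m<x
  ...     | inj₂ x<m = ⊥-elim (true≢false x<m fx)

  mate-notFirst : ∀ s → first (mate (F.enum s)) ≡ false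
  mate-notFirst s rewrite mate-involutive (first-removed s)
                        | <ᵇ-asym (toℕ (F.enum s)) (toℕ (mate (F.enum s))) (first-< s) =
    ∧-zeroʳ (removed (mate (F.enum s)))

  att : Fin t → Fin n₀
  att s = K.index (hub (F.enum s)) (proj₂ (hub-spec (first-removed s)))

  σ : Fin n₀ ⊎ (Fin t × Fin 2) → Fin n
  σ (inj₁ a)              = K.enum a
  σ (inj₂ (s , zero))     = F.enum s
  σ (inj₂ (s , suc zero)) = mate (F.enum s)

  σ-removed : ∀ s y → removed (σ (inj₂ (s , y))) ≡ true
  σ-removed s zero       = first-removed s
  σ-removed s (suc zero) = proj₂ (mate-spec (first-removed s))

  -- The values of kept x and first x are abstracted so that the inverse laws go by pattern matching.
  classify : ∀ x k → kept x ≡ k → ∀ f → first x ≡ f → Fin n₀ ⊎ (Fin t × Fin 2)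
  classify x true  kx _     _  = inj₁ (K.index x kx)
  classify x false _  true  fx = inj₂ (F.index x fx , zero)
  classify x false kx false fx = inj₂ (F.index (mate x) (mate-first kx fx) , suc zero)

  τ : Fin n → Fin n₀ ⊎ (Fin t × Fin 2)
  τ x = classify x (kept x) refl (first x) refl

  σ∘classify : ∀ x k kx f fx → σ (classify x k kx f fx) ≡ x
  σ∘classify x true  kx _     _  = K.enum-index x kx
  σ∘classify x false _  true  fx = F.enum-index x fx
  σ∘classify x false kx false fx =
    trans (cong mate (F.enum-index (mate x) (mate-first kx fx))) (mate-involutive (not-injective kx))

  classify∘σ : ∀ v k kx f fx → classify (σ v) k kx f fx ≡ v
  classify∘σ (inj₁ a)              true  kx _     _  = cong inj₁ (K.index-enum a kx)
  classify∘σ (inj₁ a)              false kx _     _  = ⊥-elim (true≢false (K.enum-true a) kx)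
  classify∘σ (inj₂ (s , y))        true  kx _     _  = ⊥-elim (kept≢removed kx (σ-removed s y) refl)
  classify∘σ (inj₂ (s , zero))     false _  true  fx = cong (λ k → inj₂ (k , zero)) (F.index-enum s fx)
  classify∘σ (inj₂ (s , zero))     false _  false fx = ⊥-elim (true≢false (F.enum-true s) fx)
  classify∘σ (inj₂ (s , suc zero)) false _  true  fx = ⊥-elim (true≢false fx (mate-notFirst s))
  classify∘σ (inj₂ (s , suc zero)) false kx false fx =
    cong (λ k → inj₂ (k , suc zero))
      (trans (F.index-cong _ (F.enum-true s) (mate-involutive (first-removed s))) (F.index-enum s (F.enum-true s)))

  φ : Fin n ↔ (Fin n₀ ⊎ (Fin t × Fin 2))
  φ = mk↔ₛ′ τ σ (λ v → classify∘σ v _ refl _ refl) (λ x → σ∘classify x _ refl _ refl)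

  σ∘τ : ∀ x → σ (τ x) ≡ x
  σ∘τ x = σ∘classify x _ refl _ refl

  σ-hub : ∀ s y → hub (σ (inj₂ (s , y))) ≡ hub (F.enum s)
  σ-hub s zero       = refl
  σ-hub s (suc zero) = hub-mate (first-removed s)

  hub-adj : ∀ a s y → (σ (inj₁ a) ~ σ (inj₂ (s , y))) ⇔ (att s ≡ a)
  hub-adj a s y = mk⇔ to from
    where
    to : K.enum a ~ σ (inj₂ (s , y)) → att s ≡ a
    to a~σ = trans (K.index-cong _ (K.enum-true a)
                      (trans (≡.sym (σ-hub s y)) (≡.sym (hub-unique (σ-removed s y) (adj-sym a~σ) (K.enum-true a)))))
                   (K.index-enum a (K.enum-true a))
    from : att s ≡ a → K.enum a ~ σ (inj₂ (s , y))
    from refl = adj-sym (subst (σ (inj₂ (s , y)) ~_) (trans (σ-hub s y) (≡.sym (K.enum-index _ _)))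
                               (proj₁ (hub-spec (σ-removed s y))))

  InPair : Fin t → Fin n → Set
  InPair s x = (x ≡ F.enum s) ⊎ (x ≡ mate (F.enum s))

  σ-inPair : ∀ s y → InPair s (σ (inj₂ (s , y)))
  σ-inPair s zero       = inj₁ refl
  σ-inPair s (suc zero) = inj₂ refl

  mate-inPair : ∀ {s x} → InPair s x → InPair s (mate x)
  mate-inPair     (inj₁ refl) = inj₂ refl
  mate-inPair {s} (inj₂ refl) = inj₁ (mate-involutive (first-removed s))

  first≢mate : ∀ s r → F.enum s ≢ mate (F.enum r)
  first≢mate s r s≡mr = true≢false r<s (<ᵇ-asym (toℕ (F.enum s)) (toℕ (F.enum r)) s<r)
    where
    r<s : (toℕ (F.enum r) <ᵇ toℕ (F.enum s)) ≡ true
    r<s = subst (λ z → (toℕ (F.enum r) <ᵇ toℕ z) ≡ true) (≡.sym s≡mr) (first-< r)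
    r≡ms : F.enum r ≡ mate (F.enum s)
    r≡ms = trans (≡.sym (mate-involutive (first-removed r))) (cong mate (≡.sym s≡mr))
    s<r : (toℕ (F.enum s) <ᵇ toℕ (F.enum r)) ≡ true
    s<r = subst (λ z → (toℕ (F.enum s) <ᵇ toℕ z) ≡ true) (≡.sym r≡ms) (first-< s)

  pairs-disjoint : ∀ {s r x} → InPair s x → InPair r x → s ≡ r
  pairs-disjoint {s} {r} (inj₁ refl) (inj₁ eq) = F.enum-injective eq
  pairs-disjoint {s} {r} (inj₁ refl) (inj₂ eq) = ⊥-elim (first≢mate s r eq)
  pairs-disjoint {s} {r} (inj₂ refl) (inj₁ eq) = ⊥-elim (first≢mate r s (≡.sym eq))
  pairs-disjoint {s} {r} (inj₂ refl) (inj₂ eq) =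
    F.enum-injective (trans (≡.sym (mate-involutive (first-removed s)))
                            (trans (cong mate eq) (mate-involutive (first-removed r))))

  σ-pair-adj : ∀ s {y z} → y ≢ z → σ (inj₂ (s , y)) ~ σ (inj₂ (s , z))
  σ-pair-adj s {zero}     {zero}     y≢z = ⊥-elim (y≢z refl)
  σ-pair-adj s {zero}     {suc zero} _   = proj₁ (mate-spec (first-removed s))
  σ-pair-adj s {suc zero} {zero}     _   = adj-sym (proj₁ (mate-spec (first-removed s)))
  σ-pair-adj s {suc zero} {suc zero} y≢z = ⊥-elim (y≢z refl)

  pair-adj : ∀ s y r z → (σ (inj₂ (s , y)) ~ σ (inj₂ (r , z))) ⇔ ((s ≡ r) × (y ≢ z))
  pair-adj s y r z = mk⇔ to from
    where
    to : σ (inj₂ (s , y)) ~ σ (inj₂ (r , z)) → (s ≡ r) × (y ≢ z)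
    to σ~σ with pairs-disjoint (mate-inPair (σ-inPair s y))
                  (subst (InPair r) (mate-unique (σ-removed s y) σ~σ (σ-removed r z)) (σ-inPair r z))
    ... | refl = refl , λ { refl → adj⇒≢ σ~σ refl }
    from : (s ≡ r) × (y ≢ z) → σ (inj₂ (s , y)) ~ σ (inj₂ (r , z))
    from (refl , y≢z) = σ-pair-adj s y≢z

  σ-adj : ∀ v w → (σ v ~ σ w) ⇔ GluedAdj G₀ att v w
  σ-adj (inj₁ a)       (inj₁ b)       = mk⇔ (λ a~b → a~b) (λ a~b → a~b)
  σ-adj (inj₁ a)       (inj₂ (s , y)) = hub-adj a s y
  σ-adj (inj₂ (s , y)) (inj₁ a)       =
    mk⇔ (Equivalence.to (hub-adj a s y) ∘ adj-sym) (adj-sym ∘ Equivalence.from (hub-adj a s y))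
  σ-adj (inj₂ (s , y)) (inj₂ (r , z)) = pair-adj s y r z

  adj⇔gluedAdj : ∀ i j → (i ~ j) ⇔ GluedAdj G₀ att (τ i) (τ j)
  adj⇔gluedAdj i j =
    mk⇔ (λ i~j → Equivalence.to (σ-adj (τ i) (τ j)) (subst₂ _~_ (≡.sym (σ∘τ i)) (≡.sym (σ∘τ j)) i~j))
        (λ g → subst₂ _~_ (σ∘τ i) (σ∘τ j) (Equivalence.from (σ-adj (τ i) (τ j)) g))

  almostTriangleFree : AlmostTriangleFree G
  almostTriangleFree = n₀ , t , G₀ , att , G₀-triangleFree , φ , adj⇔gluedAdj

-- Representations of almost triangle-free graphs

module Glued {n : ℕ} (G : Graph n) {n₀ t : ℕ} (G₀ : Graph n₀) (att : Fin t → Fin n₀)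
  (G₀-triangleFree : TriangleFree G₀) (φ : Fin n ↔ (Fin n₀ ⊎ (Fin t × Fin 2)))
  (hadj : ∀ i j → (adj G i j ≡ true) ⇔ GluedAdj G₀ att (Inverse.to φ i) (Inverse.to φ j)) where

  open GraphProperties G

  τ : Fin n → Fin n₀ ⊎ (Fin t × Fin 2)
  τ = Inverse.to φ

  τ-injective : ∀ {i j} → τ i ≡ τ j → i ≡ j
  τ-injective = Injection.injective (↔⇒↣ φ)

  IsOld IsGlued : Fin n → Set
  IsOld u    = ∃ λ a → τ u ≡ inj₁ a
  IsGlued u  = ∃ λ q → τ u ≡ inj₂ q

  old≢glued : ∀ {u v} → IsOld u → IsGlued v → u ≢ v
  old≢glued (_ , τu) (_ , τv) refl with trans (≡.sym τu) τv
  ... | ()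

  adj⇒gluedAdj : ∀ {i j ι κ} → i ~ j → τ i ≡ ι → τ j ≡ κ → GluedAdj G₀ att ι κ
  adj⇒gluedAdj {i} {j} aij refl refl = Equivalence.to (hadj i j) aij

  gluedAdj⇒adj : ∀ {i j ι κ} → τ i ≡ ι → τ j ≡ κ → GluedAdj G₀ att ι κ → i ~ j
  gluedAdj⇒adj {i} {j} refl refl = Equivalence.from (hadj i j)

  partner : Fin t → Fin 2 → Fin n
  partner s y = Inverse.from φ (inj₂ (s , other y))

  partner-glued : ∀ {s y} → IsGlued (partner s y)
  partner-glued = _ , Inverse.strictlyInverseˡ φ _

  adj-partner : ∀ {v s y} → τ v ≡ inj₂ (s , y) → adj G v (partner s y) ≡ true
  adj-partner {y = y} τv = gluedAdj⇒adj τv (Inverse.strictlyInverseˡ φ _) (refl , other-≢ y)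

  partner-unique : ∀ {v w s y q} → τ v ≡ inj₂ (s , y) → τ w ≡ inj₂ q → v ~ w → w ≡ partner s y
  partner-unique τv τw avw with adj⇒gluedAdj avw τv τw
  ... | refl , y≢z = τ-injective (trans τw (trans (cong (λ z → inj₂ (_ , z)) (≢⇒other y≢z))
                                                     (≡.sym (Inverse.strictlyInverseˡ φ _))))

  old-neighbour-unique : ∀ {u u′ v s y} → IsOld u → IsOld u′ → τ v ≡ inj₂ (s , y) →
                         u ~ v → u′ ~ v → u ≡ u′
  old-neighbour-unique (_ , τu) (_ , τu′) τv auv au′v with adj⇒gluedAdj auv τu τv | adj⇒gluedAdj au′v τu′ τv
  ... | refl | refl = τ-injective (trans τu (≡.sym τu′))

  no-triangle-on-old-edge : ∀ {u v w} → IsOld u → IsOld v → u ~ v →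
                            w ~ u → w ~ v → ⊥
  no-triangle-on-old-edge {w = w} (a , τu) (b , τv) auv awu awv with τ w in τw
  ... | inj₁ c = G₀-triangleFree a b c (adj⇒gluedAdj auv τu τv)
                   (trans (Graph.sym G₀ b c) (adj⇒gluedAdj awv τw τv)) (trans (Graph.sym G₀ a c) (adj⇒gluedAdj awu τw τu))
  ... | inj₂ (s , _) with adj⇒gluedAdj awu τw τu | adj⇒gluedAdj awv τw τv
  ...   | refl | refl = true≢false (adj⇒gluedAdj auv τu τv) (irrefl G₀ (att s))

  no-triangle-of-glued : ∀ {u v w} → IsGlued u → IsGlued v → IsGlued w →
                         u ~ v → w ~ u → w ~ v → ⊥
  no-triangle-of-glued (_ , τu) (_ , τv) (_ , τw) auv awu awv
    with adj⇒gluedAdj auv τu τv | adj⇒gluedAdj awu τw τu | adj⇒gluedAdj awv τw τv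
  ... | refl , y≢z | refl , x≢y | refl , x≢z = x≢z (trans (≢⇒other (x≢y ∘ ≡.sym)) (≡.sym (≢⇒other y≢z)))

module LowerBound {n : ℕ} (G : Graph n) {n₀ t : ℕ} (G₀ : Graph n₀) (att : Fin t → Fin n₀)
  (G₀-triangleFree : TriangleFree G₀) (φ : Fin n ↔ (Fin n₀ ⊎ (Fin t × Fin 2)))
  (hadj : ∀ i j → (adj G i j ≡ true) ⇔ GluedAdj G₀ att (Inverse.to φ i) (Inverse.to φ j))
  {p : ℕ} (R : Representation G p) where

  open GraphProperties G
  open Standard G
  open Glued G G₀ att G₀-triangleFree φ hadj
  open Representation R renaming (lines to ℓ)
  open RepresentationProperties R

  oldOld-lines : ∀ {u v x} → IsOld u → IsOld v → u ~ v → ℓ u x ≡ true → ℓ v x ≡ true →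
                 ∀ {w} → ℓ w x ≡ true → (w ≡ u) ⊎ (w ≡ v)
  oldOld-lines {u} {v} u-old v-old auv ℓu ℓv {w} ℓw with w ≟ u | w ≟ v
  ... | yes w≡u | _       = inj₁ w≡u
  ... | no _    | yes w≡v = inj₂ w≡v
  ... | no w≢u  | no w≢v  = ⊥-elim (no-triangle-on-old-edge u-old v-old auv (meet ℓw ℓu w≢u) (meet ℓw ℓv w≢v))

  gluedGlued-lines : ∀ {u v x} → IsGlued u → IsGlued v → u ~ v → ℓ u x ≡ true → ℓ v x ≡ true →
                     ∀ {w} → IsGlued w → ℓ w x ≡ true → (w ≡ u) ⊎ (w ≡ v)
  gluedGlued-lines {u} {v} u-glued v-glued auv ℓu ℓv {w} w-glued ℓw with w ≟ u | w ≟ v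
  ... | yes w≡u | _       = inj₁ w≡u
  ... | no _    | yes w≡v = inj₂ w≡v
  ... | no w≢u  | no w≢v  =
    ⊥-elim (no-triangle-of-glued u-glued v-glued w-glued auv (meet ℓw ℓu w≢u) (meet ℓw ℓv w≢v))

  oldGlued-lines : ∀ {v s y x} → τ v ≡ inj₂ (s , y) → ℓ v x ≡ true → ℓ (partner s y) x ≡ false →
                   ∀ {w} → IsGlued w → ℓ w x ≡ true → w ≡ v
  oldGlued-lines {v} τv ℓv off {w} (_ , τw) ℓw with w ≟ v
  ... | yes w≡v = w≡v
  ... | no w≢v  = ⊥-elim (true≢false (subst (λ z → ℓ z _ ≡ true) w≡partner ℓw) off)
    where w≡partner = partner-unique τv τw (meet ℓv ℓw (w≢v ∘ ≡.sym))

  data Witness (e : Edge) (x : Fin p) : Set where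
    oldOld     : ∀ {u v} → Joins e u v → IsOld u → IsOld v → ℓ u x ≡ true → ℓ v x ≡ true → Witness e x
    gluedGlued : ∀ {u v} → Joins e u v → IsGlued u → IsGlued v → ℓ u x ≡ true → ℓ v x ≡ true → Witness e x
    oldGlued   : ∀ {u v s y} → Joins e u v → IsOld u → τ v ≡ inj₂ (s , y) →
                 ℓ v x ≡ true → ℓ (partner s y) x ≡ false → Witness e x

  witness : ∀ e → ∃ (Witness e)
  witness (u , v , uv) with τ u in τu | τ v in τv
  ... | inj₁ _ | inj₁ _ = let (x , ℓu , ℓv) = commonPoint (joins-adj (forward {p = uv})) in
                          x , oldOld forward (_ , τu) (_ , τv) ℓu ℓv
  ... | inj₂ _ | inj₂ _ = let (x , ℓu , ℓv) = commonPoint (joins-adj (forward {p = uv})) in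
                          x , gluedGlued forward (_ , τu) (_ , τv) ℓu ℓv
  ... | inj₁ _ | inj₂ _ = let (x , ℓv , off) = pointOff (adj⇒≢ (adj-partner τv)) in
                          x , oldGlued forward (_ , τu) τv ℓv off
  ... | inj₂ _ | inj₁ _ = let (x , ℓu , off) = pointOff (adj⇒≢ (adj-partner τu)) in
                          x , oldGlued backward (_ , τv) τu ℓu off

  oldOld-noGlued : ∀ {e x u v w} → Joins e u v → IsOld u → IsOld v → ℓ u x ≡ true → ℓ v x ≡ true →
                   IsGlued w → ℓ w x ≡ true → ⊥
  oldOld-noGlued e∼ u-old v-old ℓu ℓv w-glued ℓw with oldOld-lines u-old v-old (joins-adj e∼) ℓu ℓv ℓw
  ... | inj₁ refl = old≢glued u-old w-glued refl
  ... | inj₂ refl = old≢glued v-old w-glued refl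

  gluedGlued-oldGlued : ∀ {e x u v v′ s y} → Joins e u v → IsGlued u → IsGlued v →
                        ℓ u x ≡ true → ℓ v x ≡ true →
                        τ v′ ≡ inj₂ (s , y) → ℓ v′ x ≡ true → ℓ (partner s y) x ≡ false → ⊥
  gluedGlued-oldGlued e∼ u-glued v-glued ℓu ℓv τv′ ℓv′ off =
    adj⇒≢ (joins-adj e∼) (trans (oldGlued-lines τv′ ℓv′ off u-glued ℓu)
                                (≡.sym (oldGlued-lines τv′ ℓv′ off v-glued ℓv)))

  witness-injective : ∀ {e e′ x} → Witness e x → Witness e′ x → e ≡ e′
  witness-injective (oldOld e∼ u-old v-old ℓu ℓv) (oldOld e′∼ _ _ ℓu′ ℓv′) =
    joins-within e∼ e′∼ (lines ℓu′) (lines ℓv′)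
    where lines = oldOld-lines u-old v-old (joins-adj e∼) ℓu ℓv
  witness-injective (oldOld e∼ u-old v-old ℓu ℓv) (gluedGlued _ u′-glued _ ℓu′ _) =
    ⊥-elim (oldOld-noGlued e∼ u-old v-old ℓu ℓv u′-glued ℓu′)
  witness-injective (oldOld e∼ u-old v-old ℓu ℓv) (oldGlued _ _ τv′ ℓv′ _) =
    ⊥-elim (oldOld-noGlued e∼ u-old v-old ℓu ℓv (_ , τv′) ℓv′)
  witness-injective (gluedGlued _ u-glued _ ℓu _) (oldOld e′∼ u′-old v′-old ℓu′ ℓv′) =
    ⊥-elim (oldOld-noGlued e′∼ u′-old v′-old ℓu′ ℓv′ u-glued ℓu)
  witness-injective (gluedGlued e∼ u-glued v-glued ℓu ℓv) (gluedGlued e′∼ u′-glued v′-glued ℓu′ ℓv′) =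
    joins-within e∼ e′∼ (lines u′-glued ℓu′) (lines v′-glued ℓv′)
    where lines = gluedGlued-lines u-glued v-glued (joins-adj e∼) ℓu ℓv
  witness-injective (gluedGlued e∼ u-glued v-glued ℓu ℓv) (oldGlued _ _ τv′ ℓv′ off′) =
    ⊥-elim (gluedGlued-oldGlued e∼ u-glued v-glued ℓu ℓv τv′ ℓv′ off′)
  witness-injective (oldGlued _ _ τv ℓv _) (oldOld e′∼ u′-old v′-old ℓu′ ℓv′) =
    ⊥-elim (oldOld-noGlued e′∼ u′-old v′-old ℓu′ ℓv′ (_ , τv) ℓv)
  witness-injective (oldGlued _ _ τv ℓv off) (gluedGlued e′∼ u′-glued v′-glued ℓu′ ℓv′) =
    ⊥-elim (gluedGlued-oldGlued e′∼ u′-glued v′-glued ℓu′ ℓv′ τv ℓv off)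
  witness-injective (oldGlued e∼ u-old τv ℓv off) (oldGlued e′∼ u′-old τv′ ℓv′ _)
    with oldGlued-lines τv ℓv off (_ , τv′) ℓv′
  ... | refl = joins-within e∼ e′∼
                 (inj₁ (old-neighbour-unique u′-old u-old τv (joins-adj e′∼) (joins-adj e∼))) (inj₂ refl)

  Private : Fin n → Fin p → Set
  Private i x = (ℓ i x ≡ true) × (∀ {w} → ℓ w x ≡ true → w ≡ i)

  witness-not-private : ∀ {e x i} → Witness e x → Private i x → degree G i ≤ 1 → ⊥
  witness-not-private (oldOld e∼ _ _ ℓu ℓv) (_ , only) _ =
    adj⇒≢ (joins-adj e∼) (trans (only ℓu) (≡.sym (only ℓv)))
  witness-not-private (gluedGlued e∼ _ _ ℓu ℓv) (_ , only) _ =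
    adj⇒≢ (joins-adj e∼) (trans (only ℓu) (≡.sym (only ℓv)))
  witness-not-private (oldGlued e∼ u-old τv ℓv _) (_ , only) deg≤1 with only ℓv
  ... | refl
    with ≤-trans (countF≥2 (adj G _) (adj-sym (joins-adj e∼)) (adj-partner τv) (old≢glued u-old partner-glued)) deg≤1
  ...   | s≤s ()

  leafPrivate : ∀ {i} → degree G i ≡ 1 → ∃ (Private i)
  leafPrivate {i} deg≡1 with countF≥1⇒∃ (adj G i) (subst (1 ≤_) (≡.sym deg≡1) (s≤s z≤n))
  ... | j , aij with pointOff (adj⇒≢ aij)
  ...   | x , ℓix , ℓjx = x , ℓix , only
    where
    only : ∀ {w} → ℓ w x ≡ true → w ≡ i
    only {w} ℓwx with w ≟ i
    ... | yes w≡i = w≡i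
    ... | no w≢i with countF≤1⇒unique (adj G i) (≤-reflexive deg≡1) aij (meet ℓix ℓwx (w≢i ∘ ≡.sym))
    ...   | refl = ⊥-elim (true≢false ℓwx ℓjx)

  isolatedPrivate : ∀ {i x} → degree G i ≡ 0 → ℓ i x ≡ true → Private i x
  isolatedPrivate {i} {x} deg≡0 ℓix = ℓix , only
    where
    only : ∀ {w} → ℓ w x ≡ true → w ≡ i
    only {w} ℓwx with w ≟ i
    ... | yes w≡i = w≡i
    ... | no w≢i = ⊥-elim (true≢false (meet ℓix ℓwx (w≢i ∘ ≡.sym)) (countF≡0⇒false (adj G i) deg≡0 w))

  twoPointsOn : ∀ i → ∃₂ λ x y → (ℓ i x ≡ true) × (ℓ i y ≡ true) × (x ≢ y)
  twoPointsOn i = countF≥2⇒∃₂ (ℓ i) (size≥2 i)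

  pointOn : Fin n → Fin 2 → Fin p
  pointOn i zero       = proj₁ (twoPointsOn i)
  pointOn i (suc zero) = proj₁ (proj₂ (twoPointsOn i))

  pointOn-on : ∀ i b → ℓ i (pointOn i b) ≡ true
  pointOn-on i zero       = let (_ , _ , ℓx , _ , _) = twoPointsOn i in ℓx
  pointOn-on i (suc zero) = let (_ , _ , _ , ℓy , _) = twoPointsOn i in ℓy

  pointOn-injective : ∀ i {b b′} → pointOn i b ≡ pointOn i b′ → b ≡ b′
  pointOn-injective i {zero}     {zero}     _  = refl
  pointOn-injective i {zero}     {suc zero} eq = ⊥-elim (proj₂ (proj₂ (proj₂ (proj₂ (twoPointsOn i)))) eq)
  pointOn-injective i {suc zero} {zero}     eq = ⊥-elim (proj₂ (proj₂ (proj₂ (proj₂ (twoPointsOn i)))) (≡.sym eq))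
  pointOn-injective i {suc zero} {suc zero} _  = refl

  place : Point → Fin p
  place (edgePoint e)         = proj₁ (witness e)
  place (leafPoint i l)       = proj₁ (leafPrivate (leaf-degree l))
  place (isolatedPoint b i _) = pointOn i b

  place-leaf : ∀ {i} l → Private i (place (leafPoint i l))
  place-leaf l = proj₂ (leafPrivate (leaf-degree l))

  place-isolated : ∀ {i} b o → Private i (place (isolatedPoint b i o))
  place-isolated {i} b o = isolatedPrivate (isolated-degree o) (pointOn-on i b)

  private-unique : ∀ {i j x} → Private i x → Private j x → i ≡ j
  private-unique (ℓix , _) (_ , only) = only ℓix

  leaf-degree≤1 : ∀ {i} → isLeaf i ≡ true → degree G i ≤ 1
  leaf-degree≤1 = ≤-reflexive ∘ leaf-degree

  isolated-degree≤1 : ∀ {i} → isIsolated i ≡ true → degree G i ≤ 1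
  isolated-degree≤1 o = subst (_≤ 1) (≡.sym (isolated-degree o)) z≤n

  edge-not-private : ∀ e {i x} → place (edgePoint e) ≡ x → Private i x → degree G i ≤ 1 → ⊥
  edge-not-private e refl = witness-not-private (proj₂ (witness e))

  place-injective : ∀ {q r} → place q ≡ place r → q ≡ r
  place-injective {edgePoint e} {edgePoint e′} eq =
    cong edgePoint (witness-injective (proj₂ (witness e)) (subst (Witness e′) (≡.sym eq) (proj₂ (witness e′))))
  place-injective {edgePoint e} {leafPoint i l} eq =
    ⊥-elim (edge-not-private e eq (place-leaf l) (leaf-degree≤1 l))
  place-injective {edgePoint e} {isolatedPoint b i o} eq =
    ⊥-elim (edge-not-private e eq (place-isolated b o) (isolated-degree≤1 o))
  place-injective {leafPoint i l} {edgePoint e} eq =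
    ⊥-elim (edge-not-private e (≡.sym eq) (place-leaf l) (leaf-degree≤1 l))
  place-injective {isolatedPoint b i o} {edgePoint e} eq =
    ⊥-elim (edge-not-private e (≡.sym eq) (place-isolated b o) (isolated-degree≤1 o))
  place-injective {leafPoint i l} {leafPoint i′ l′} eq
    with private-unique (place-leaf l) (subst (Private i′) (≡.sym eq) (place-leaf l′))
  ... | refl = cong (leafPoint i) (Bool-UIP l l′)
  place-injective {leafPoint i l} {isolatedPoint b i′ o} eq
    with private-unique (place-leaf l) (subst (Private i′) (≡.sym eq) (place-isolated b o))
  ... | refl with trans (≡.sym (leaf-degree l)) (isolated-degree o)
  ...   | ()
  place-injective {isolatedPoint b i o} {leafPoint i′ l} eq
    with private-unique (place-leaf l) (subst (Private i) eq (place-isolated b o))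
  ... | refl with trans (≡.sym (leaf-degree l)) (isolated-degree o)
  ...   | ()
  place-injective {isolatedPoint b i o} {isolatedPoint b′ i′ o′} eq
    with private-unique (place-isolated b o) (subst (Private i′) (≡.sym eq) (place-isolated b′ o′))
  ... | refl with pointOn-injective i {b} {b′} eq
  ...   | refl = cong (isolatedPoint b i) (Bool-UIP o o′)

  lowerBound : N ≤ p
  lowerBound = injective⇒≤ (decode-injective ∘ place-injective)

almostTriangleFree⇒isV : ∀ {n} (G : Graph n) → AlmostTriangleFree G → IsV G (Standard.N G)
almostTriangleFree⇒isV G (_ , _ , G₀ , att , G₀-triangleFree , φ , hadj) =
  Standard.standard G , λ p R → LowerBound.lowerBound G G₀ att G₀-triangleFree φ hadj R

mainTheorem2 : ∀ {n : ℕ} (G : Graph n) →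
    IsV G (edges G + leaves G + 2 * isolated G) ⇔ AlmostTriangleFree G
mainTheorem2 G = mk⇔ (Decomposition.almostTriangleFree G ∘ isV⇒noHeavyTriangle G) (almostTriangleFree⇒isV G)
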